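{- For a weighted digraph $\Gamma$ with forest dimension $v$, the rank of its Kirchhoff matrix $L$ is $n-v$ and the rank of its normalized matrix of maximum out forests $\bar J$ is $v$.
   Context: $\Gamma$ is loopless on $\{1,\dots,n\}$, $n>1$, with arc weights $\varepsilon_{ij}>0$. $L=(\ell_{ij})$: $\ell_{ij}=-\varepsilon_{ji}$ for $j\ne i$, $\ell_{ii}=\sum_{k\ne i}\varepsilon_{ki}$. Weight of a subgraph = product of arc weights (1 if none), weight of a set = sum (0 if empty). A diverging forest: no circuits, all indegrees $\le1$; roots are indegree-0 vertices; weak components are trees diverging from roots. A maximum out forest is a spanning diverging forest with the maximum number of arcs; the forest dimension $v$ is its number of roots. $\mathcal F_k$: spanning diverging forests with $k$ arcs; $\mathcal F_k^{j\to i}$: those in which $i$ lies in the tree rooted at $j$. $\bar J_{ij}=\varepsilon(\mathcal F^{j\to i}_{n-v})/\varepsilon(\mathcal F_{n-v})$. -}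

module Defs where

open import Level using (Level; _⊔_)
open import Data.Nat as ℕ using (ℕ; zero; suc; _∸_)
open import Data.Bool using (Bool; true; false; _∧_; if_then_else_)
open import Data.Maybe using (Maybe; just; nothing; maybe; is-just)
open import Data.Fin using (Fin; zero; suc; _≟_)
open import Data.List as List using (List; []; _∷_; filterᵇ; allFin)
open import Data.Product using (Σ; _×_; _,_)
open import Relation.Nullary using (¬_; does)
open import Relation.Binary.PropositionalEquality using (_≡_)
open import Algebra.Structures using (IsCommutativeRing)
open import Function using (_∘_)
import Data.Sum

record OrderedField (c ℓ : Level) : Set (Level.suc (c ⊔ ℓ)) where
  infixl 7 _*_
  infixl 6 _+_
  infix  4 _<_
  field
    Carrier : Set c
    _+_ _*_ : Carrier → Carrier → Carrier
    -_      : Carrier → Carrier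
    0# 1#   : Carrier
    _⁻¹     : Carrier → Carrier
    _<_     : Carrier → Carrier → Set ℓ
    isCommutativeRing : IsCommutativeRing _≡_ _+_ _*_ -_ 0# 1#
    0≢1     : ¬ (0# ≡ 1#)
    ⁻¹-inverse : ∀ x → ¬ (x ≡ 0#) → x * (x ⁻¹) ≡ 1#
    <-irrefl : ∀ x → ¬ (x < x)
    <-trans  : ∀ {x y z} → x < y → y < z → x < z
    <-trichotomy : ∀ x y → (x < y) Data.Sum.⊎ ((x ≡ y) Data.Sum.⊎ (y < x))
    +-mono-< : ∀ {x y} z → x < y → x + z < y + z
    *-pos    : ∀ {x y} → 0# < x → 0# < y → 0# < x * y

module Over {c ℓ : Level} (F : OrderedField c ℓ) where
  open OrderedField F

  ∑ : {n : ℕ} → (Fin n → Carrier) → Carrier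
  ∑ {zero}  f = 0#
  ∑ {suc n} f = f zero + ∑ (f ∘ suc)

  ∏ : {n : ℕ} → (Fin n → Carrier) → Carrier
  ∏ {zero}  f = 1#
  ∏ {suc n} f = f zero * ∏ (f ∘ suc)

  allᵇ : {n : ℕ} → (Fin n → Bool) → Bool
  allᵇ {zero}  f = true
  allᵇ {suc n} f = f zero ∧ allᵇ (f ∘ suc)

  sumList : List Carrier → Carrier
  sumList = List.foldr _+_ 0#

  Matrix : ℕ → Set c
  Matrix n = Fin n → Fin n → Carrier

  LinIndepCols : {n r : ℕ} → Matrix n → (Fin r → Fin n) → Set c
  LinIndepCols {n} {r} M cols =
    (a : Fin r → Carrier) →
    (∀ i → ∑ (λ k → a k * M i (cols k)) ≡ 0#) →
    ∀ k → a k ≡ 0#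

  HasRank : {n : ℕ} → Matrix n → ℕ → Set c
  HasRank {n} M r =
    Σ (Fin r → Fin n) (λ cols → LinIndepCols M cols) ×
    ((cols : Fin (suc r) → Fin n) → ¬ LinIndepCols M cols)

  record WDigraph (n : ℕ) : Set (c ⊔ ℓ) where
    field
      arc      : Fin n → Fin n → Bool
      ε        : Fin n → Fin n → Carrier
      loopless : ∀ i → arc i i ≡ false
      positive : ∀ i j → arc i j ≡ true → 0# < ε i j

  module _ {n : ℕ} (Γ : WDigraph n) where
    open WDigraph Γ

    w : Fin n → Fin n → Carrier
    w i j = if arc i j then ε i j else 0#

    kirchhoff : Matrix n
    kirchhoff i j =
      if does (i ≟ j)
      then ∑ (λ k → if does (k ≟ i) then 0# else w k i)
      else - w j i

    -- A spanning subgraph with all indegrees ≤ 1 is encoded by its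
    -- "parent" map: par i = just j  iff  the arc (j → i) is in the subgraph.
    ParentMap : Set
    ParentMap = Fin n → Maybe (Fin n)

    allMaps : (m : ℕ) → List (Fin m → Maybe (Fin n))
    allMaps zero    = (λ ()) ∷ []
    allMaps (suc m) =
      List.concatMap
        (λ x → List.map (λ g → λ { zero → x ; (suc k) → g k }) (allMaps m))
        (nothing ∷ List.map just (allFin n))

    usesArcs : ParentMap → Bool
    usesArcs p = allᵇ (λ i → maybe (λ j → arc j i) true (p i))

    rootWithin : ℕ → ParentMap → Fin n → Maybe (Fin n)
    rootWithin fuel p i with p i
    ... | nothing = just i
    rootWithin zero       p i | just j = nothing
    rootWithin (suc fuel) p i | just j = rootWithin fuel p j

    rootOf : ParentMap → Fin n → Maybe (Fin n)
    rootOf p = rootWithin n p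

    -- no circuits: from every vertex, the parent chain reaches a root
    -- (a chain without repetitions has fewer than n steps)
    acyclic : ParentMap → Bool
    acyclic p = allᵇ (λ i → is-just (rootOf p i))

    isForest : ParentMap → Bool
    isForest p = usesArcs p ∧ acyclic p

    numArcs : ParentMap → ℕ
    numArcs p = List.length (filterᵇ (λ i → is-just (p i)) (allFin n))

    numRoots : ParentMap → ℕ
    numRoots p = n ∸ numArcs p

    weight : ParentMap → Carrier
    weight p = ∏ (λ i → maybe (λ j → ε j i) 1# (p i))

    𝓕 : ℕ → List ParentMap
    𝓕 k = filterᵇ (λ p → isForest p ∧ does (numArcs p ℕ.≟ k)) (allMaps n)

    𝓕→ : ℕ → Fin n → Fin n → List ParentMap
    𝓕→ k j i = filterᵇ (λ p → maybe (λ r → does (r ≟ j)) false (rootOf p i)) (𝓕 k)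

    εset : List ParentMap → Carrier
    εset fs = sumList (List.map weight fs)

    IsForestDimension : ℕ → Set
    IsForestDimension v =
      Σ ParentMap (λ p → (isForest p ≡ true) × (numRoots p ≡ v) ×
        (∀ q → isForest q ≡ true → numArcs q ℕ.≤ numArcs p))

    Jbar : ℕ → Matrix n
    Jbar v i j = εset (𝓕→ (n ∸ v) j i) * (εset (𝓕 (n ∸ v)) ⁻¹)

{-# OPTIONS --safe #-}

-- Let J be the matrix with J i j = ε(𝓕^{j→i}_{n-v}).  Every column of J is L-harmonic: in the
-- flux Σ_k ε_ki (J i j - J k j), the forests in which i is a root contribute nothing, because
-- maximality puts every in-neighbour of i into the tree of i; the other forests are grouped by
-- the parent a of i, and once the arc a → i is detached the flux is antisymmetric in a and k.
-- Conversely, a maximum principle along the arcs of a fixed maximum out forest p₀ shows that an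
-- L-harmonic vector vanishing on the v roots of p₀ vanishes.  Hence J̄ has rank v: its columns at
-- the roots of p₀ are diagonal there (maximality again), and each column is determined by its
-- entries at the roots.  And L has rank n - v: its columns at the non-roots are independent, and
-- each column of L is L applied to a vector vanishing on the roots.

module Submission where

open import Defs
open import Level using (Level)
open import Algebra.Bundles using (CommutativeRing)
open import Algebra.Structures using (IsCommutativeRing)
open import Data.Bool using (Bool; true; false; _∧_; _∨_; not; if_then_else_; T?)
open import Data.Bool.Properties using (T-≡; ∧-conicalˡ; ∧-conicalʳ; ∨-zeroʳ; ⇔→≡; if-float)
open import Data.Empty using (⊥-elim)
open import Data.Fin as Fin using (Fin; zero; suc; _≟_; punchIn; toℕ)
open import Data.Fin.Properties using (suc-injective; all?; ¬∀⟶∃¬; pigeonhole; toℕ<n)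
open import Data.List as List using (List; []; _∷_; allFin; filterᵇ)
import Data.List.Properties as List
open import Data.List.Membership.Propositional using (_∈_)
open import Data.List.Membership.Propositional.Properties using (∈-lookup; ∈-filter⁺; ∈-filter⁻; ∈-allFin)
open import Data.List.Relation.Unary.All as All using ()
open import Data.List.Relation.Unary.AllPairs using (_∷_)
open import Data.List.Relation.Unary.Any as Any using ()
open import Data.List.Relation.Unary.Any.Properties using (lookup-index)
open import Data.List.Relation.Unary.Unique.Propositional using (Unique)
import Data.List.Relation.Unary.Unique.Propositional.Properties as Unique
open import Data.Maybe using (Maybe; just; nothing; maybe; is-just; is-nothing)
open import Data.Maybe.Properties using (just-injective; ≡-dec)
open import Data.Nat as ℕ using (ℕ; zero; suc; _∸_)
open import Data.Nat.Induction using (<-rec)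
import Data.Nat.Properties as ℕ
open import Data.Product using (Σ-syntax; ∃-syntax; ∃₂; _×_; _,_; proj₁; proj₂)
open import Data.Sum using (_⊎_; inj₁; inj₂)
open import Data.Vec.Functional as Vector using (insertAt; updateAt)
open import Data.Vec.Functional.Properties using (insertAt-lookup; insertAt-punchIn; updateAt-updates; updateAt-minimal)
open import Function using (_∘_; id; const; mk⇔; Equivalence)
open import Relation.Binary.Definitions using (DecidableEquality; Trichotomous; tri<; tri≈; tri>)
open import Relation.Binary.PropositionalEquality
import Relation.Binary.Construct.StrictToNonStrict as StrictToNonStrict
open import Relation.Binary.Structures using (IsStrictTotalOrder; IsTotalOrder)
open import Relation.Nullary using (¬_; Dec; does; yes; no)
open import Relation.Nullary.Decidable using (dec-true; dec-false; does-⇔)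

private
  variable
    A B : Set

does≡true⇒ : ∀ {a} {P : Set a} (P? : Dec P) → does P? ≡ true → P
does≡true⇒ (yes p) _ = p

is-nothing⇒≡nothing : ∀ {m : Maybe A} → is-nothing m ≡ true → m ≡ nothing
is-nothing⇒≡nothing {m = nothing} _ = refl

lookup-injective : ∀ {xs : List A} → Unique xs → ∀ {i j} → List.lookup xs i ≡ List.lookup xs j → i ≡ j
lookup-injective (_    ∷ _) {zero}  {zero}  _       = refl
lookup-injective (x∉xs ∷ _) {zero}  {suc j} x≡xⱼ    = ⊥-elim (All.lookup x∉xs (∈-lookup j) x≡xⱼ)
lookup-injective (x∉xs ∷ _) {suc i} {zero}  xᵢ≡x    = ⊥-elim (All.lookup x∉xs (∈-lookup i) (sym xᵢ≡x))
lookup-injective (_ ∷ xs!)  {suc i} {suc j} xᵢ≡xⱼ   = cong suc (lookup-injective xs! xᵢ≡xⱼ)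

length-filterᵇ-complement : ∀ (P : A → Bool) xs →
                            List.length (filterᵇ P xs) ℕ.+ List.length (filterᵇ (not ∘ P) xs) ≡ List.length xs
length-filterᵇ-complement P []       = refl
length-filterᵇ-complement P (x ∷ xs) with P x
... | true  = cong suc (length-filterᵇ-complement P xs)
... | false = trans (ℕ.+-suc _ _) (cong suc (length-filterᵇ-complement P xs))

module Enumeration {m} (P : Fin m → Bool) where

  selected : List (Fin m)
  selected = filterᵇ P (allFin m)

  enumerate : Fin (List.length selected) → Fin m
  enumerate = List.lookup selected

  enumerate-sound : ∀ k → P (enumerate k) ≡ true
  enumerate-sound k = Equivalence.to T-≡ (proj₂ (∈-filter⁻ (T? ∘ P) {xs = allFin m} (∈-lookup k)))

  enumerate-injective : ∀ {k k′} → enumerate k ≡ enumerate k′ → k ≡ k′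
  enumerate-injective = lookup-injective (Unique.filter⁺ (T? ∘ P) (Unique.allFin⁺ m))

  enumerate-complete : ∀ x → P x ≡ true → ∃[ k ] enumerate k ≡ x
  enumerate-complete x Px≡true = Any.index x∈selected , sym (lookup-index x∈selected)
    where
    x∈selected : x ∈ selected
    x∈selected = ∈-filter⁺ (T? ∘ P) (∈-allFin x) (Equivalence.from T-≡ Px≡true)

count : ∀ {m} → (Fin m → Bool) → ℕ
count {zero}  f = 0
count {suc m} f = if f zero then suc (count (f ∘ suc)) else count (f ∘ suc)

length-filterᵇ-tabulate : ∀ {m} (P : A → Bool) (g : Fin m → A) → List.length (filterᵇ P (List.tabulate g)) ≡ count (P ∘ g)
length-filterᵇ-tabulate {m = zero}  P g = refl
length-filterᵇ-tabulate {m = suc m} P g with P (g zero)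
... | true  = cong suc (length-filterᵇ-tabulate P (g ∘ suc))
... | false = length-filterᵇ-tabulate P (g ∘ suc)

count-cong : ∀ {m} {f g : Fin m → Bool} → f ≗ g → count f ≡ count g
count-cong {zero}  f≗g = refl
count-cong {suc m} f≗g = cong₂ (λ b c → if b then suc c else c) (f≗g zero) (count-cong (f≗g ∘ suc))

count-update : ∀ {m} (f g : Fin m → Bool) i → f i ≡ false → g i ≡ true → (∀ j → ¬ j ≡ i → f j ≡ g j) → count g ≡ suc (count f)
count-update {suc m} f g zero    f₀≡false g₀≡true f≗g rewrite f₀≡false | g₀≡true =
  cong suc (count-cong (λ j → sym (f≗g (suc j) (λ ()))))
count-update {suc m} f g (suc i) fᵢ≡false gᵢ≡true f≗g
  with count-update (f ∘ suc) (g ∘ suc) i fᵢ≡false gᵢ≡true (λ j j≢i → f≗g (suc j) (j≢i ∘ suc-injective))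
... | tail-updated rewrite f≗g zero (λ ()) with g zero
...   | true  = cong suc tail-updated
...   | false = tail-updated

module _ {c ℓ : Level} (F : OrderedField c ℓ) where
  open OrderedField F
  open Over F
  open IsCommutativeRing isCommutativeRing
    using (_-_; +-assoc; +-comm; *-assoc; *-comm; +-identityˡ; +-identityʳ; *-identityˡ; *-identityʳ;
           -‿inverseˡ; -‿inverseʳ; distribˡ; zeroˡ; zeroʳ)

  commutativeRing : CommutativeRing c c
  commutativeRing = record { isCommutativeRing = isCommutativeRing }

  open CommutativeRing commutativeRing using (ring; +-abelianGroup)
  open import Algebra.Properties.Ring ring using (-‿distribˡ-*; -‿distribʳ-*; -‿involutive; -0#≈0#; x[y-z]≈xy-xz)
  open import Algebra.Properties.AbelianGroup +-abelianGroup using (⁻¹-∙-comm)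
  open import Algebra.Properties.Group (CommutativeRing.+-group commutativeRing) using (x∙y⁻¹≈ε⇒x≈y)

  open import Algebra.Properties.CommutativeSemigroup (CommutativeRing.+-commutativeSemigroup commutativeRing)
    using () renaming (interchange to +-interchange; x∙yz≈y∙xz to +-left-comm)
  open import Algebra.Properties.CommutativeSemigroup (CommutativeRing.*-commutativeSemigroup commutativeRing)
    using () renaming (x∙yz≈y∙xz to *-left-comm)

  open ≡-Reasoning

  <-compare : Trichotomous _≡_ _<_
  <-compare x y with <-trichotomy x y
  ... | inj₁ x<y         = tri< x<y (λ { refl → <-irrefl x x<y }) (λ y<x → <-irrefl x (<-trans x<y y<x))
  ... | inj₂ (inj₁ refl) = tri≈ (<-irrefl x) refl (<-irrefl x)
  ... | inj₂ (inj₂ y<x)  = tri> (λ x<y → <-irrefl x (<-trans x<y y<x)) (λ { refl → <-irrefl x y<x }) y<x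

  <-isStrictTotalOrder : IsStrictTotalOrder _≡_ _<_
  <-isStrictTotalOrder = record
    { isStrictPartialOrder = record
      { isEquivalence = isEquivalence
      ; irrefl        = λ { refl → <-irrefl _ }
      ; trans         = <-trans
      ; <-resp-≈      = resp₂ _<_
      }
    ; compare = <-compare
    }

  open StrictToNonStrict _≡_ _<_ using (_≤_; <⇒≤)
  open IsTotalOrder (StrictToNonStrict.isTotalOrder _≡_ _<_ <-isStrictTotalOrder)
    using (antisym; total) renaming (refl to ≤-refl; trans to ≤-trans)
  open IsStrictTotalOrder <-isStrictTotalOrder using () renaming (_≟_ to _≟ᶠ_)

  ≤-<-trans : ∀ {x y z} → x ≤ y → y < z → x < z
  ≤-<-trans = StrictToNonStrict.≤-<-trans _≡_ _<_ sym <-trans (proj₂ (resp₂ _<_))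

  pos⇒≢0 : ∀ {x} → 0# < x → ¬ x ≡ 0#
  pos⇒≢0 0<x refl = <-irrefl 0# 0<x

  neg-mono-< : ∀ {x y} → x < y → - y < - x
  neg-mono-< {x} {y} x<y = subst₂ _<_ (cancel x y) (trans (cong (y +_) (+-comm (- x) (- y))) (cancel y x))
                                      (+-mono-< (- x + - y) x<y)
    where
    cancel : ∀ a b → a + (- a + - b) ≡ - b
    cancel a b = trans (sym (+-assoc a (- a) (- b))) (trans (cong (_+ - b) (-‿inverseʳ a)) (+-identityˡ (- b)))

  neg-mono-≤ : ∀ {x y} → x ≤ y → - y ≤ - x
  neg-mono-≤ (inj₁ x<y)  = inj₁ (neg-mono-< x<y)
  neg-mono-≤ (inj₂ refl) = inj₂ refl

  x≤y⇒0≤y-x : ∀ {x y} → x ≤ y → 0# ≤ y - x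
  x≤y⇒0≤y-x {x} (inj₁ x<y) = inj₁ (subst (_< _) (-‿inverseʳ x) (+-mono-< (- x) x<y))
  x≤y⇒0≤y-x {x} (inj₂ refl) = inj₂ (sym (-‿inverseʳ x))

  0<1 : 0# < 1#
  0<1 with <-compare 0# 1#
  ... | tri< 0<1 _ _ = 0<1
  ... | tri≈ _ 0≡1 _ = ⊥-elim (0≢1 0≡1)
  ... | tri> _ _ 1<0 = ⊥-elim (<-irrefl 1# (<-trans 1<0 (subst (0# <_) [-1][-1]≡1 (*-pos 0<-1 0<-1))))
    where
    0<-1 : 0# < - 1#
    0<-1 = subst (_< - 1#) -0#≈0# (neg-mono-< 1<0)
    [-1][-1]≡1 : - 1# * - 1# ≡ 1#
    [-1][-1]≡1 = trans (sym (-‿distribˡ-* 1# (- 1#))) (trans (cong -_ (*-identityˡ (- 1#))) (-‿involutive 1#))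

  pos+nonneg : ∀ {x y} → 0# < x → 0# ≤ y → 0# < x + y
  pos+nonneg {x} {y} 0<x 0≤y = ≤-<-trans 0≤y (subst (_< x + y) (+-identityˡ y) (+-mono-< y 0<x))

  nonneg+nonneg : ∀ {x y} → 0# ≤ x → 0# ≤ y → 0# ≤ x + y
  nonneg+nonneg         (inj₁ 0<x)  0≤y = inj₁ (pos+nonneg 0<x 0≤y)
  nonneg+nonneg {y = y} (inj₂ refl) 0≤y = subst (0# ≤_) (sym (+-identityˡ y)) 0≤y

  nonneg*nonneg : ∀ {x y} → 0# ≤ x → 0# ≤ y → 0# ≤ x * y
  nonneg*nonneg         (inj₁ 0<x)  (inj₁ 0<y)  = inj₁ (*-pos 0<x 0<y)
  nonneg*nonneg {x}     (inj₁ _)    (inj₂ refl) = inj₂ (sym (zeroʳ x))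
  nonneg*nonneg {y = y} (inj₂ refl) _           = inj₂ (sym (zeroˡ y))

  *-cancelˡ-0 : ∀ {x y} → ¬ x ≡ 0# → x * y ≡ 0# → y ≡ 0#
  *-cancelˡ-0 {x} {y} x≢0 xy≡0 = begin
    y                ≡⟨ *-identityʳ y ⟨
    y * 1#           ≡⟨ cong (y *_) (⁻¹-inverse x x≢0) ⟨
    y * (x * x ⁻¹)   ≡⟨ *-assoc y x (x ⁻¹) ⟨
    y * x * x ⁻¹     ≡⟨ cong (_* x ⁻¹) (trans (*-comm y x) xy≡0) ⟩
    0# * x ⁻¹        ≡⟨ zeroˡ (x ⁻¹) ⟩
    0#               ∎

  *-nonzero : ∀ {x y} → ¬ x ≡ 0# → ¬ y ≡ 0# → ¬ x * y ≡ 0#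
  *-nonzero x≢0 y≢0 xy≡0 = y≢0 (*-cancelˡ-0 x≢0 xy≡0)

  ⁻¹-nonzero : ∀ {x} → ¬ x ≡ 0# → ¬ x ⁻¹ ≡ 0#
  ⁻¹-nonzero {x} x≢0 x⁻¹≡0 = 0≢1 (trans (sym (zeroʳ x)) (trans (cong (x *_) (sym x⁻¹≡0)) (⁻¹-inverse x x≢0)))

  ∑-cong : ∀ {n} {f g : Fin n → Carrier} → (∀ i → f i ≡ g i) → ∑ f ≡ ∑ g
  ∑-cong {zero}  f≗g = refl
  ∑-cong {suc n} f≗g = cong₂ _+_ (f≗g zero) (∑-cong (f≗g ∘ suc))

  ∑-zero : ∀ {n} {f : Fin n → Carrier} → (∀ i → f i ≡ 0#) → ∑ f ≡ 0#
  ∑-zero {zero}  f≗0 = refl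
  ∑-zero {suc n} f≗0 = trans (cong₂ _+_ (f≗0 zero) (∑-zero (f≗0 ∘ suc))) (+-identityˡ 0#)

  ∑-0 : ∀ n → ∑ {n} (λ _ → 0#) ≡ 0#
  ∑-0 n = ∑-zero {n} (λ _ → refl)

  ∑-distrib-+ : ∀ {n} (f g : Fin n → Carrier) → ∑ (λ i → f i + g i) ≡ ∑ f + ∑ g
  ∑-distrib-+ {zero}  f g = sym (+-identityˡ 0#)
  ∑-distrib-+ {suc n} f g = trans (cong (f zero + g zero +_) (∑-distrib-+ (f ∘ suc) (g ∘ suc)))
    (+-interchange (f zero) (g zero) (∑ (f ∘ suc)) (∑ (g ∘ suc)))

  ∑-neg : ∀ {n} (f : Fin n → Carrier) → ∑ (λ i → - f i) ≡ - ∑ f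
  ∑-neg {zero}  f = sym -0#≈0#
  ∑-neg {suc n} f = trans (cong (- f zero +_) (∑-neg (f ∘ suc))) (⁻¹-∙-comm (f zero) (∑ (f ∘ suc)))

  ∑-distrib-- : ∀ {n} (f g : Fin n → Carrier) → ∑ (λ i → f i - g i) ≡ ∑ f - ∑ g
  ∑-distrib-- f g = trans (∑-distrib-+ f (λ i → - g i)) (cong (∑ f +_) (∑-neg g))

  *-distribˡ-∑ : ∀ {n} a (f : Fin n → Carrier) → a * ∑ f ≡ ∑ (λ i → a * f i)
  *-distribˡ-∑ {zero}  a f = zeroʳ a
  *-distribˡ-∑ {suc n} a f = trans (distribˡ a (f zero) (∑ (f ∘ suc))) (cong (a * f zero +_) (*-distribˡ-∑ a (f ∘ suc)))

  *-distribʳ-∑ : ∀ {n} a (f : Fin n → Carrier) → ∑ f * a ≡ ∑ (λ i → f i * a)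
  *-distribʳ-∑ a f = trans (*-comm (∑ f) a) (trans (*-distribˡ-∑ a f) (∑-cong (λ i → *-comm a (f i))))

  ∑-comm : ∀ {m n} (f : Fin m → Fin n → Carrier) → ∑ (λ i → ∑ (f i)) ≡ ∑ (λ j → ∑ (λ i → f i j))
  ∑-comm {zero} {n} f = sym (∑-0 n)
  ∑-comm {suc m} f = trans (cong (∑ (f zero) +_) (∑-comm (f ∘ suc))) (sym (∑-distrib-+ (f zero) _))

  ∑-select : ∀ {n} (i : Fin n) (f : Fin n → Carrier) → ∑ (λ j → if does (i ≟ j) then f j else 0#) ≡ f i
  ∑-select {suc n} zero f = trans (cong (f zero +_) (∑-0 n)) (+-identityʳ (f zero))
  ∑-select (suc i) f = trans (+-identityˡ _) (∑-select i (f ∘ suc))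

  ∑-remove : ∀ {n} (i : Fin (suc n)) (f : Fin (suc n) → Carrier) → ∑ f ≡ f i + ∑ (f ∘ punchIn i)
  ∑-remove         zero    f = refl
  ∑-remove {suc n} (suc i) f = trans (cong (f zero +_) (∑-remove i (f ∘ suc)))
    (+-left-comm (f zero) (f (suc i)) (∑ (f ∘ suc ∘ punchIn i)))

  ∑-antisymmetric : ∀ {n} (S : Fin n → Fin n → Carrier) → ∑ (λ a → ∑ (λ k → S a k - S k a)) ≡ 0#
  ∑-antisymmetric S = begin
    ∑ (λ a → ∑ (λ k → S a k - S k a))                   ≡⟨ ∑-cong (λ a → ∑-distrib-- (S a) (λ k → S k a)) ⟩
    ∑ (λ a → ∑ (S a) - ∑ (λ k → S k a))                 ≡⟨ ∑-distrib-- (λ a → ∑ (S a)) (λ a → ∑ (λ k → S k a)) ⟩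
    ∑ (λ a → ∑ (S a)) - ∑ (λ a → ∑ (λ k → S k a))       ≡⟨ cong (λ t → ∑ (λ a → ∑ (S a)) - t) (∑-comm (λ a k → S k a)) ⟩
    ∑ (λ a → ∑ (S a)) - ∑ (λ k → ∑ (λ a → S k a))       ≡⟨ -‿inverseʳ _ ⟩
    0#                                                   ∎

  ∑-nonneg : ∀ {n} {f : Fin n → Carrier} → (∀ i → 0# ≤ f i) → 0# ≤ ∑ f
  ∑-nonneg {zero}  0≤f = ≤-refl
  ∑-nonneg {suc n} 0≤f = nonneg+nonneg (0≤f zero) (∑-nonneg (0≤f ∘ suc))

  ∑-nonneg-≡0 : ∀ {n} {f : Fin n → Carrier} → (∀ i → 0# ≤ f i) → ∑ f ≡ 0# → ∀ i → f i ≡ 0#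
  ∑-nonneg-≡0 {suc n} {f} 0≤f ∑f≡0 i with 0≤f zero
  ... | inj₁ 0<f₀ = ⊥-elim (pos⇒≢0 (pos+nonneg 0<f₀ (∑-nonneg (0≤f ∘ suc))) ∑f≡0)
  ... | inj₂ 0≡f₀ with i
  ...   | zero   = sym 0≡f₀
  ...   | suc i′ = ∑-nonneg-≡0 (0≤f ∘ suc) (trans (sym (+-identityˡ _)) (trans (cong (_+ ∑ (f ∘ suc)) 0≡f₀) ∑f≡0)) i′

  δ : ∀ {n} → Fin n → Fin n → Carrier
  δ x j = if does (x ≟ j) then 1# else 0#

  ∑-*δ : ∀ {n} (f : Fin n → Carrier) x → ∑ (λ j → f j * δ x j) ≡ f x
  ∑-*δ f x = trans (∑-cong f*δ) (∑-select x f)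
    where
    f*δ : ∀ j → f j * δ x j ≡ (if does (x ≟ j) then f j else 0#)
    f*δ j with does (x ≟ j)
    ... | true  = *-identityʳ (f j)
    ... | false = zeroʳ (f j)

  ∑-combination-comm : ∀ {m n} (M : Fin n → Carrier) (a : Fin m → Carrier) (y : Fin m → Fin n → Carrier) →
                       ∑ (λ j → M j * ∑ (λ t → a t * y t j)) ≡ ∑ (λ t → a t * ∑ (λ j → M j * y t j))
  ∑-combination-comm M a y = begin
    ∑ (λ j → M j * ∑ (λ t → a t * y t j))   ≡⟨ ∑-cong (λ j → *-distribˡ-∑ (M j) (λ t → a t * y t j)) ⟩
    ∑ (λ j → ∑ (λ t → M j * (a t * y t j))) ≡⟨ ∑-comm (λ j t → M j * (a t * y t j)) ⟩
    ∑ (λ t → ∑ (λ j → M j * (a t * y t j))) ≡⟨ ∑-cong (λ t → ∑-cong (λ j → *-left-comm (M j) (a t) (y t j))) ⟩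
    ∑ (λ t → ∑ (λ j → a t * (M j * y t j))) ≡⟨ ∑-cong (λ t → *-distribˡ-∑ (a t) (λ j → M j * y t j)) ⟨
    ∑ (λ t → a t * ∑ (λ j → M j * y t j))   ∎

  argmax : ∀ {m} → Fin m → (f : Fin m → Carrier) → ∃[ k ] (∀ j → f j ≤ f k)
  argmax {suc zero}    _ f = zero , λ { zero → ≤-refl }
  argmax {suc (suc m)} _ f with argmax zero (f ∘ suc)
  ... | k , k-max with total (f zero) (f (suc k))
  ...   | inj₁ f₀≤fₖ = suc k , λ { zero → f₀≤fₖ ; (suc j) → k-max j }
  ...   | inj₂ fₖ≤f₀ = zero  , λ { zero → ≤-refl ; (suc j) → ≤-trans (k-max j) fₖ≤f₀ }

  ∏-cong : ∀ {n} {f g : Fin n → Carrier} → (∀ i → f i ≡ g i) → ∏ f ≡ ∏ g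
  ∏-cong {zero}  f≗g = refl
  ∏-cong {suc n} f≗g = cong₂ _*_ (f≗g zero) (∏-cong (f≗g ∘ suc))

  ∏-pos : ∀ {n} {f : Fin n → Carrier} → (∀ i → 0# < f i) → 0# < ∏ f
  ∏-pos {zero}  0<f = 0<1
  ∏-pos {suc n} 0<f = *-pos (0<f zero) (∏-pos (0<f ∘ suc))

  ∏-update : ∀ {n} (f g : Fin n → Carrier) i → f i ≡ 1# → (∀ j → ¬ j ≡ i → f j ≡ g j) → ∏ g ≡ g i * ∏ f
  ∏-update {suc n} f g zero f₀≡1 f≗g = cong (g zero *_) (begin
    ∏ (g ∘ suc)              ≡⟨ *-identityˡ _ ⟨
    1# * ∏ (g ∘ suc)         ≡⟨ cong₂ _*_ f₀≡1 (∏-cong (λ j → f≗g (suc j) (λ ()))) ⟨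
    f zero * ∏ (f ∘ suc)     ∎)
  ∏-update {suc n} f g (suc i) fᵢ≡1 f≗g = begin
    g zero * ∏ (g ∘ suc)
      ≡⟨ cong (g zero *_) (∏-update (f ∘ suc) (g ∘ suc) i fᵢ≡1 (λ j j≢i → f≗g (suc j) (j≢i ∘ suc-injective))) ⟩
    g zero * (g (suc i) * ∏ (f ∘ suc))
      ≡⟨ *-left-comm (g zero) (g (suc i)) _ ⟩
    g (suc i) * (g zero * ∏ (f ∘ suc))
      ≡⟨ cong (λ t → g (suc i) * (t * ∏ (f ∘ suc))) (f≗g zero (λ ())) ⟨
    g (suc i) * (f zero * ∏ (f ∘ suc)) ∎

  if-guard-0 : ∀ b {x} → (b ≡ true → x ≡ 0#) → (if b then x else 0#) ≡ 0#
  if-guard-0 true  x≡0 = x≡0 refl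
  if-guard-0 false x≡0 = refl

  *-if : ∀ x b y → x * (if b then y else 0#) ≡ (if b then x * y else 0#)
  *-if x true  y = refl
  *-if x false y = zeroʳ x

  -- The summand of a flux after reattaching a tree: αₓ says that x lies in the tree of i, βₓ that
  -- it lies in the tree of j.
  exchange-antisymmetric : ∀ αₐ αₖ βₐ βₖ (wₐ wₖ c : Carrier) →
    wₖ * ((if αₐ then 0# else (if βₐ then wₐ * c else 0#)) -
          (if αₐ then 0# else (if (if αₖ then βₐ else βₖ) then wₐ * c else 0#)))
    ≡ (if αₐ ∨ αₖ then 0# else (if βₐ then wₖ * (wₐ * c) else 0#)) -
      (if αₖ ∨ αₐ then 0# else (if βₖ then wₐ * (wₖ * c) else 0#))
  exchange-antisymmetric true  αₖ    βₐ βₖ wₐ wₖ c rewrite ∨-zeroʳ αₖ =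
    trans (cong (wₖ *_) (-‿inverseʳ 0#)) (trans (zeroʳ wₖ) (sym (-‿inverseʳ 0#)))
  exchange-antisymmetric false true  βₐ βₖ wₐ wₖ c =
    trans (cong (wₖ *_) (-‿inverseʳ _)) (trans (zeroʳ wₖ) (sym (-‿inverseʳ 0#)))
  exchange-antisymmetric false false βₐ βₖ wₐ wₖ c = trans (x[y-z]≈xy-xz wₖ _ _)
    (cong₂ _-_ (*-if wₖ βₐ (wₐ * c))
               (trans (*-if wₖ βₖ (wₐ * c)) (cong (λ t → if βₖ then t else 0#) (*-left-comm wₖ wₐ c))))

  ∑ᴸ : (A → Carrier) → List A → Carrier
  ∑ᴸ f xs = sumList (List.map f xs)

  ∑ᴸ-cong : {f g : A → Carrier} (xs : List A) → (∀ x → f x ≡ g x) → ∑ᴸ f xs ≡ ∑ᴸ g xs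
  ∑ᴸ-cong []       f≗g = refl
  ∑ᴸ-cong (x ∷ xs) f≗g = cong₂ _+_ (f≗g x) (∑ᴸ-cong xs f≗g)

  ∑ᴸ-zero : {f : A → Carrier} (xs : List A) → (∀ x → f x ≡ 0#) → ∑ᴸ f xs ≡ 0#
  ∑ᴸ-zero []       f≗0 = refl
  ∑ᴸ-zero (x ∷ xs) f≗0 = trans (cong₂ _+_ (f≗0 x) (∑ᴸ-zero xs f≗0)) (+-identityˡ 0#)

  ∑ᴸ-distrib-+ : (f g : A → Carrier) (xs : List A) → ∑ᴸ (λ x → f x + g x) xs ≡ ∑ᴸ f xs + ∑ᴸ g xs
  ∑ᴸ-distrib-+ f g []       = sym (+-identityˡ 0#)
  ∑ᴸ-distrib-+ f g (x ∷ xs) = trans (cong (f x + g x +_) (∑ᴸ-distrib-+ f g xs))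
    (+-interchange (f x) (g x) (∑ᴸ f xs) (∑ᴸ g xs))

  ∑ᴸ-neg : (f : A → Carrier) (xs : List A) → ∑ᴸ (λ x → - f x) xs ≡ - ∑ᴸ f xs
  ∑ᴸ-neg f []       = sym -0#≈0#
  ∑ᴸ-neg f (x ∷ xs) = trans (cong (- f x +_) (∑ᴸ-neg f xs)) (⁻¹-∙-comm (f x) (∑ᴸ f xs))

  ∑ᴸ-distrib-- : (f g : A → Carrier) (xs : List A) → ∑ᴸ (λ x → f x - g x) xs ≡ ∑ᴸ f xs - ∑ᴸ g xs
  ∑ᴸ-distrib-- f g xs = trans (∑ᴸ-distrib-+ f (λ x → - g x) xs) (cong (∑ᴸ f xs +_) (∑ᴸ-neg g xs))

  *-distribˡ-∑ᴸ : ∀ a (f : A → Carrier) (xs : List A) → a * ∑ᴸ f xs ≡ ∑ᴸ (λ x → a * f x) xs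
  *-distribˡ-∑ᴸ a f []       = zeroʳ a
  *-distribˡ-∑ᴸ a f (x ∷ xs) = trans (distribˡ a (f x) (∑ᴸ f xs)) (cong (a * f x +_) (*-distribˡ-∑ᴸ a f xs))

  ∑ᴸ-++ : (f : A → Carrier) (xs ys : List A) → ∑ᴸ f (xs List.++ ys) ≡ ∑ᴸ f xs + ∑ᴸ f ys
  ∑ᴸ-++ f []       ys = sym (+-identityˡ _)
  ∑ᴸ-++ f (x ∷ xs) ys = trans (cong (f x +_) (∑ᴸ-++ f xs ys)) (sym (+-assoc (f x) _ _))

  ∑ᴸ-map : (f : B → Carrier) (g : A → B) (xs : List A) → ∑ᴸ f (List.map g xs) ≡ ∑ᴸ (f ∘ g) xs
  ∑ᴸ-map f g []       = refl
  ∑ᴸ-map f g (x ∷ xs) = cong (f (g x) +_) (∑ᴸ-map f g xs)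

  ∑ᴸ-concatMap : (f : B → Carrier) (g : A → List B) (xs : List A) →
                 ∑ᴸ f (List.concatMap g xs) ≡ ∑ᴸ (λ x → ∑ᴸ f (g x)) xs
  ∑ᴸ-concatMap f g []       = refl
  ∑ᴸ-concatMap f g (x ∷ xs) = trans (∑ᴸ-++ f (g x) (List.concatMap g xs)) (cong (∑ᴸ f (g x) +_) (∑ᴸ-concatMap f g xs))

  ∑ᴸ-filterᵇ : (P : A → Bool) (f : A → Carrier) (xs : List A) →
               ∑ᴸ f (filterᵇ P xs) ≡ ∑ᴸ (λ x → if P x then f x else 0#) xs
  ∑ᴸ-filterᵇ P f []       = refl
  ∑ᴸ-filterᵇ P f (x ∷ xs) with P x
  ... | true  = cong (f x +_) (∑ᴸ-filterᵇ P f xs)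
  ... | false = trans (∑ᴸ-filterᵇ P f xs) (sym (+-identityˡ _))

  ∑ᴸ-∑-comm : ∀ {n} (f : Fin n → A → Carrier) (xs : List A) → ∑ᴸ (λ x → ∑ (λ k → f k x)) xs ≡ ∑ (λ k → ∑ᴸ (f k) xs)
  ∑ᴸ-∑-comm {n = n} f []       = sym (∑-0 n)
  ∑ᴸ-∑-comm         f (x ∷ xs) = trans (cong (∑ (λ k → f k x) +_) (∑ᴸ-∑-comm f xs)) (sym (∑-distrib-+ (λ k → f k x) _))

  ∑ᴸ-nonneg : {f : A → Carrier} (xs : List A) → (∀ x → 0# ≤ f x) → 0# ≤ ∑ᴸ f xs
  ∑ᴸ-nonneg []       0≤f = ≤-refl
  ∑ᴸ-nonneg (x ∷ xs) 0≤f = nonneg+nonneg (0≤f x) (∑ᴸ-nonneg xs 0≤f)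

  ∑ᴸ-comm : (f : A → B → Carrier) (xs : List A) (ys : List B) →
            ∑ᴸ (λ x → ∑ᴸ (f x) ys) xs ≡ ∑ᴸ (λ y → ∑ᴸ (λ x → f x y) xs) ys
  ∑ᴸ-comm f []       ys = sym (∑ᴸ-zero ys (λ _ → refl))
  ∑ᴸ-comm f (x ∷ xs) ys = trans (cong (∑ᴸ (f x) ys +_) (∑ᴸ-comm f xs ys)) (sym (∑ᴸ-distrib-+ (f x) _ ys))

  ∑ᴸ-allFin : ∀ {n} (f : Fin n → Carrier) → ∑ᴸ f (allFin n) ≡ ∑ f
  ∑ᴸ-allFin f = ∑ᴸ-tabulate f id
    where
    ∑ᴸ-tabulate : ∀ {n} (f : B → Carrier) (g : Fin n → B) → ∑ᴸ f (List.tabulate g) ≡ ∑ (f ∘ g)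
    ∑ᴸ-tabulate {n = zero}  f g = refl
    ∑ᴸ-tabulate {n = suc n} f g = cong (f (g zero) +_) (∑ᴸ-tabulate f (g ∘ suc))

  -- Linear dependence

  LinearlyDependent : ∀ {m d} → (Fin m → Fin d → Carrier) → Set c
  LinearlyDependent {m} u =
    Σ[ a ∈ (Fin m → Carrier) ] (Σ[ t ∈ Fin m ] ¬ a t ≡ 0#) × (∀ i → ∑ (λ t → a t * u t i) ≡ 0#)

  ∑-insertAt : ∀ {d} (b : Fin d → Carrier) t₀ α (f : Fin (suc d) → Carrier) →
               ∑ (λ x → insertAt b t₀ α x * f x) ≡ α * f t₀ + ∑ (λ t → b t * f (punchIn t₀ t))
  ∑-insertAt b t₀ α f = trans (∑-remove t₀ (λ x → insertAt b t₀ α x * f x))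
    (cong₂ _+_ (cong (_* f t₀) (insertAt-lookup b t₀ α))
               (∑-cong (λ t → cong (_* f (punchIn t₀ t)) (insertAt-punchIn b t₀ α t))))

  dependent-extend : ∀ {m d} (u : Fin (suc m) → Fin d → Carrier) → LinearlyDependent (u ∘ suc) → LinearlyDependent u
  dependent-extend {m} u (b , (t , bₜ≢0) , Σbu≡0) =
    a , (suc t , bₜ≢0) , λ i → trans (cong (_+ ∑ (λ t → b t * u (suc t) i)) (zeroˡ (u zero i))) (trans (+-identityˡ _) (Σbu≡0 i))
    where
    a : Fin (suc m) → Carrier
    a zero    = 0#
    a (suc t) = b t

  dependent-dropFirst : ∀ {m d} (u : Fin m → Fin (suc d) → Carrier) → (∀ t → u t zero ≡ 0#) →
                        LinearlyDependent (λ t i → u t (suc i)) → LinearlyDependent u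
  dependent-dropFirst u first≡0 (a , a≢0 , Σau≡0) = a , a≢0 , λ
    { zero    → ∑-zero (λ t → trans (cong (a t *_) (first≡0 t)) (zeroʳ (a t)))
    ; (suc i) → Σau≡0 i }

  module Pivot {m d} (u : Fin (suc m) → Fin (suc d) → Carrier) (t₀ : Fin (suc m)) (π≢0 : ¬ u t₀ zero ≡ 0#) where
    π⁻¹ : Carrier
    π⁻¹ = u t₀ zero ⁻¹

    v : Fin m → Fin (suc d) → Carrier
    v = u ∘ punchIn t₀

    eliminated : Fin m → Fin d → Carrier
    eliminated t i = v t (suc i) - v t zero * (π⁻¹ * u t₀ (suc i))

    dependent-pivot : LinearlyDependent eliminated → LinearlyDependent u
    dependent-pivot (b , (t , bₜ≢0) , Σbe≡0) = a , (punchIn t₀ t , a≢0) , Σau≡0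
      where
      S₀ α : Carrier
      S₀ = ∑ (λ t → b t * v t zero)
      α  = - (S₀ * π⁻¹)
      a : Fin (suc m) → Carrier
      a  = insertAt b t₀ α
      a≢0 : ¬ a (punchIn t₀ t) ≡ 0#
      a≢0 = bₜ≢0 ∘ trans (sym (insertAt-punchIn b t₀ α t))
      Σau≡0 : ∀ i → ∑ (λ x → a x * u x i) ≡ 0#
      Σau≡0 zero = begin
        ∑ (λ x → a x * u x zero)   ≡⟨ ∑-insertAt b t₀ α (λ x → u x zero) ⟩
        α * u t₀ zero + S₀         ≡⟨ cong (_+ S₀) (begin
            - (S₀ * π⁻¹) * u t₀ zero   ≡⟨ -‿distribˡ-* (S₀ * π⁻¹) (u t₀ zero) ⟨
            - (S₀ * π⁻¹ * u t₀ zero)   ≡⟨ cong -_ (*-assoc S₀ π⁻¹ (u t₀ zero)) ⟩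
            - (S₀ * (π⁻¹ * u t₀ zero)) ≡⟨ cong (λ z → - (S₀ * z)) (trans (*-comm π⁻¹ (u t₀ zero)) (⁻¹-inverse _ π≢0)) ⟩
            - (S₀ * 1#)                ≡⟨ cong -_ (*-identityʳ S₀) ⟩
            - S₀                       ∎) ⟩
        - S₀ + S₀                  ≡⟨ -‿inverseˡ S₀ ⟩
        0#                         ∎
      Σau≡0 (suc i) = begin
        ∑ (λ x → a x * u x (suc i))
          ≡⟨ ∑-insertAt b t₀ α (λ x → u x (suc i)) ⟩
        α * C + ∑ (λ t → b t * v t (suc i))
          ≡⟨ +-comm _ _ ⟩
        ∑ (λ t → b t * v t (suc i)) + α * C
          ≡⟨ cong (∑ (λ t → b t * v t (suc i)) +_) αC≡-S₀κ ⟩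
        ∑ (λ t → b t * v t (suc i)) - S₀ * κ
          ≡⟨ cong (λ z → ∑ (λ t → b t * v t (suc i)) - z) (*-distribʳ-∑ κ (λ t → b t * v t zero)) ⟩
        ∑ (λ t → b t * v t (suc i)) - ∑ (λ t → b t * v t zero * κ)
          ≡⟨ ∑-distrib-- (λ t → b t * v t (suc i)) (λ t → b t * v t zero * κ) ⟨
        ∑ (λ t → b t * v t (suc i) - b t * v t zero * κ)
          ≡⟨ ∑-cong (λ t → trans (cong (λ z → b t * v t (suc i) - z) (*-assoc (b t) (v t zero) κ))
                                 (sym (x[y-z]≈xy-xz (b t) (v t (suc i)) (v t zero * κ)))) ⟩
        ∑ (λ t → b t * eliminated t i)
          ≡⟨ Σbe≡0 i ⟩
        0# ∎
        where
        C κ : Carrier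
        C = u t₀ (suc i)
        κ = π⁻¹ * C
        αC≡-S₀κ : α * C ≡ - (S₀ * κ)
        αC≡-S₀κ = trans (sym (-‿distribˡ-* (S₀ * π⁻¹) C)) (cong -_ (*-assoc S₀ π⁻¹ C))

  suc-vectors-dependent : ∀ d (u : Fin (suc d) → Fin d → Carrier) → LinearlyDependent u
  suc-vectors-dependent zero    u = (λ _ → 1#) , (zero , 0≢1 ∘ sym) , (λ ())
  suc-vectors-dependent (suc d) u with all? (λ t → u t zero ≟ᶠ 0#)
  ... | yes first≡0 = dependent-dropFirst u first≡0
                        (dependent-extend (λ t i → u t (suc i)) (suc-vectors-dependent d (λ t i → u (suc t) (suc i))))
  ... | no ¬first≡0 with ¬∀⟶∃¬ _ _ (λ t → u t zero ≟ᶠ 0#) ¬first≡0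
  ...   | t₀ , π≢0 = dependent-pivot (suc-vectors-dependent d eliminated)
    where open Pivot u t₀ π≢0

  module _ {n : ℕ} (Γ : WDigraph n) where
    open WDigraph Γ

    -- Parent chains and roots

    record HasRoot (p : ParentMap Γ) (z r : Fin n) : Set where
      constructor reach
      field
        steps   : ℕ
        reaches : rootWithin Γ steps p z ≡ just r

    rootWithin-at-root : ∀ k (p : ParentMap Γ) z → p z ≡ nothing → rootWithin Γ k p z ≡ just z
    rootWithin-at-root k p z pz≡nothing rewrite pz≡nothing = refl

    rootWithin-step : ∀ k (p : ParentMap Γ) z {y} → p z ≡ just y → rootWithin Γ (suc k) p z ≡ rootWithin Γ k p y
    rootWithin-step k p z pz≡y rewrite pz≡y = refl

    rootWithin-zero : ∀ (p : ParentMap Γ) z {y} → p z ≡ just y → rootWithin Γ 0 p z ≡ nothing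
    rootWithin-zero p z pz≡y rewrite pz≡y = refl

    rootWithin-root : ∀ k (p : ParentMap Γ) z {r} → rootWithin Γ k p z ≡ just r → p r ≡ nothing
    rootWithin-root k p z eq with p z in pz
    rootWithin-root k       p z refl | nothing = pz
    rootWithin-root (suc k) p z eq   | just y  = rootWithin-root k p y eq

    rootWithin-mono : ∀ {k k′} (p : ParentMap Γ) z {r} → k ℕ.≤ k′ → rootWithin Γ k p z ≡ just r → rootWithin Γ k′ p z ≡ just r
    rootWithin-mono p z k≤k′ eq with p z
    rootWithin-mono p z k≤k′           eq | nothing = eq
    rootWithin-mono p z (ℕ.s≤s k≤k′)   eq | just y  = rootWithin-mono p y k≤k′ eq

    rootWithin-unique : ∀ k k′ (p : ParentMap Γ) z {r r′} →
                        rootWithin Γ k p z ≡ just r → rootWithin Γ k′ p z ≡ just r′ → r ≡ r′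
    rootWithin-unique k k′ p z eq eq′ with ℕ.≤-total k k′
    ... | inj₁ k≤k′ = just-injective (trans (sym (rootWithin-mono p z k≤k′ eq)) eq′)
    ... | inj₂ k′≤k = just-injective (trans (sym eq) (rootWithin-mono p z k′≤k eq′))

    ancestor : ParentMap Γ → Fin n → ℕ → Fin n
    ancestor p z zero    = z
    ancestor p z (suc t) with p z
    ... | nothing = z
    ... | just y  = ancestor p y t

    ancestor-+ : ∀ (p : ParentMap Γ) z t s → ancestor p z (t ℕ.+ s) ≡ ancestor p (ancestor p z t) s
    ancestor-+ p z zero    s = refl
    ancestor-+ p z (suc t) s with p z in pz
    ... | just y  = ancestor-+ p y t s
    ... | nothing = root-fixed s
      where
      root-fixed : ∀ s → z ≡ ancestor p z s
      root-fixed zero    = refl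
      root-fixed (suc s) rewrite pz = refl

    ancestor-root-stable : ∀ (p : ParentMap Γ) z t s → p (ancestor p z t) ≡ nothing → p (ancestor p z (t ℕ.+ s)) ≡ nothing
    ancestor-root-stable p z t s pₐ≡nothing =
      subst (λ x → p x ≡ nothing) (sym (trans (ancestor-+ p z t s) (root-fixed s))) pₐ≡nothing
      where
      root-fixed : ∀ s → ancestor p (ancestor p z t) s ≡ ancestor p z t
      root-fixed zero    = refl
      root-fixed (suc s) rewrite pₐ≡nothing = refl

    rootWithin⇒ancestor : ∀ k (p : ParentMap Γ) z {r} → rootWithin Γ k p z ≡ just r → ancestor p z k ≡ r
    rootWithin⇒ancestor k p z eq with p z in pz
    rootWithin⇒ancestor zero    p z refl | nothing = refl
    rootWithin⇒ancestor (suc k) p z refl | nothing rewrite pz = refl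
    rootWithin⇒ancestor (suc k) p z eq   | just y  rewrite pz = rootWithin⇒ancestor k p y eq

    ancestor⇒rootWithin : ∀ k (p : ParentMap Γ) z → p (ancestor p z k) ≡ nothing → rootWithin Γ k p z ≡ just (ancestor p z k)
    ancestor⇒rootWithin zero    p z pₐ≡nothing rewrite pₐ≡nothing = refl
    ancestor⇒rootWithin (suc k) p z pₐ≡nothing with p z
    ... | nothing = refl
    ... | just y  = ancestor⇒rootWithin k p y pₐ≡nothing

    -- A parent chain that meets no root within n steps repeats a vertex, so it cycles forever.
    rootWithin⇒rootOf : ∀ k (p : ParentMap Γ) z {r} → rootWithin Γ k p z ≡ just r → rootOf Γ p z ≡ just r
    rootWithin⇒rootOf k p z eq with p (ancestor p z n) in pₙ
    ... | nothing = trans (ancestor⇒rootWithin n p z pₙ) (cong just (rootWithin-unique n k p z (ancestor⇒rootWithin n p z pₙ) eq))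
    ... | just _  = ⊥-elim (never-root k (subst (λ x → p x ≡ nothing) (sym (rootWithin⇒ancestor k p z eq)) (rootWithin-root k p z eq)))
      where
      repeat : ∃₂ λ i j → i Fin.< j × ancestor p z (toℕ i) ≡ ancestor p z (toℕ j)
      repeat = pigeonhole ℕ.≤-refl (λ t → ancestor p z (toℕ t))
      a b : ℕ
      a = toℕ (proj₁ repeat)
      b = toℕ (proj₁ (proj₂ repeat))
      a<b : a ℕ.< b
      a<b = proj₁ (proj₂ (proj₂ repeat))
      b≤n : b ℕ.≤ n
      b≤n = ℕ.≤-pred (toℕ<n (proj₁ (proj₂ repeat)))
      periodic : ∀ s → ancestor p z (b ℕ.+ s) ≡ ancestor p z (a ℕ.+ s)
      periodic s = begin
        ancestor p z (b ℕ.+ s)                ≡⟨ ancestor-+ p z b s ⟩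
        ancestor p (ancestor p z b) s         ≡⟨ cong (λ x → ancestor p x s) (proj₂ (proj₂ (proj₂ repeat))) ⟨
        ancestor p (ancestor p z a) s         ≡⟨ ancestor-+ p z a s ⟨
        ancestor p z (a ℕ.+ s)                ∎
      early-root : ∀ K → K ℕ.≤ n → ¬ p (ancestor p z K) ≡ nothing
      early-root K K≤n pₖ with () ← trans (sym pₙ)
        (subst (λ t → p (ancestor p z t) ≡ nothing) (ℕ.m+[n∸m]≡n K≤n) (ancestor-root-stable p z K (n ℕ.∸ K) pₖ))
      never-root : ∀ K → ¬ p (ancestor p z K) ≡ nothing
      never-root = <-rec _ step
        where
        step : ∀ K → (∀ {K′} → K′ ℕ.< K → ¬ p (ancestor p z K′) ≡ nothing) → ¬ p (ancestor p z K) ≡ nothing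
        step K rec with K ℕ.≤? n
        ... | yes K≤n = early-root K K≤n
        ... | no  K≰n = rec a+s<K ∘ subst (λ x → p x ≡ nothing) (trans (cong (ancestor p z) (sym b+s≡K)) (periodic s))
          where
          s : ℕ
          s = K ℕ.∸ b
          b+s≡K : b ℕ.+ s ≡ K
          b+s≡K = ℕ.m+[n∸m]≡n (ℕ.≤-trans b≤n (ℕ.<⇒≤ (ℕ.≰⇒> K≰n)))
          a+s<K : a ℕ.+ s ℕ.< K
          a+s<K = subst (a ℕ.+ s ℕ.<_) b+s≡K (ℕ.+-monoˡ-< s a<b)

    module _ {p : ParentMap Γ} where

      HasRoot-unique : ∀ {z r r′} → HasRoot p z r → HasRoot p z r′ → r ≡ r′
      HasRoot-unique {z} (reach k eq) (reach k′ eq′) = rootWithin-unique k k′ p z eq eq′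

      HasRoot⇒root : ∀ {z r} → HasRoot p z r → p r ≡ nothing
      HasRoot⇒root {z} (reach k eq) = rootWithin-root k p z eq

      HasRoot-self : ∀ {z} → p z ≡ nothing → HasRoot p z z
      HasRoot-self {z} pz≡nothing = reach 0 (rootWithin-at-root 0 p z pz≡nothing)



    HasRoot⇒rootOf : ∀ (p : ParentMap Γ) {z r} → HasRoot p z r → rootOf Γ p z ≡ just r
    HasRoot⇒rootOf p {z} (reach k eq) = rootWithin⇒rootOf k p z eq

    rootOf⇒HasRoot : ∀ (p : ParentMap Γ) {z r} → rootOf Γ p z ≡ just r → HasRoot p z r
    rootOf⇒HasRoot p eq = reach n eq

    rootOf-root : ∀ (p : ParentMap Γ) {r} → p r ≡ nothing → rootOf Γ p r ≡ just r
    rootOf-root p pᵣ≡nothing = HasRoot⇒rootOf p (HasRoot-self pᵣ≡nothing)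

    rootWithin-cong : ∀ k {p q : ParentMap Γ} → p ≗ q → ∀ z → rootWithin Γ k p z ≡ rootWithin Γ k q z
    rootWithin-cong k {p} {q} p≗q z with p z | q z | p≗q z
    ... | nothing | .nothing | refl = refl
    rootWithin-cong zero    p≗q z | just y | .(just y) | refl = refl
    rootWithin-cong (suc k) p≗q z | just y | .(just y) | refl = rootWithin-cong k p≗q y

    rootOf-cong : ∀ {p q : ParentMap Γ} → p ≗ q → ∀ z → rootOf Γ p z ≡ rootOf Γ q z
    rootOf-cong = rootWithin-cong n

    -- Forests and adding or removing an arc

    allᵇ⇒ : ∀ {m} (f : Fin m → Bool) → allᵇ f ≡ true → ∀ i → f i ≡ true
    allᵇ⇒ {suc m} f all≡true zero    = ∧-conicalˡ _ _ all≡true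
    allᵇ⇒ {suc m} f all≡true (suc i) = allᵇ⇒ (f ∘ suc) (∧-conicalʳ (f zero) _ all≡true) i

    ⇒allᵇ : ∀ {m} (f : Fin m → Bool) → (∀ i → f i ≡ true) → allᵇ f ≡ true
    ⇒allᵇ {zero}  f f≡true = refl
    ⇒allᵇ {suc m} f f≡true = cong₂ _∧_ (f≡true zero) (⇒allᵇ (f ∘ suc) (f≡true ∘ suc))

    allᵇ-cong : ∀ {m} {f g : Fin m → Bool} → f ≗ g → allᵇ f ≡ allᵇ g
    allᵇ-cong {zero}  f≗g = refl
    allᵇ-cong {suc m} f≗g = cong₂ _∧_ (f≗g zero) (allᵇ-cong (f≗g ∘ suc))

    UsesArcs : ParentMap Γ → Set
    UsesArcs p = ∀ i j → p i ≡ just j → arc j i ≡ true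

    Acyclic : ParentMap Γ → Set
    Acyclic p = ∀ z → ∃[ r ] HasRoot p z r

    record IsForest (p : ParentMap Γ) : Set where
      constructor forest
      field
        uses-arcs : UsesArcs p
        has-roots : Acyclic p

    open IsForest public

    isForest⇒IsForest : ∀ {p} → isForest Γ p ≡ true → IsForest p
    isForest⇒IsForest {p} p-forest = forest uses roots
      where
      uses : UsesArcs p
      uses i j pᵢ≡j = subst (λ m → maybe (λ j → arc j i) true m ≡ true) pᵢ≡j (allᵇ⇒ _ (∧-conicalˡ _ _ p-forest) i)
      roots : Acyclic p
      roots z with rootOf Γ p z in eq | allᵇ⇒ _ (∧-conicalʳ (usesArcs Γ p) _ p-forest) z
      ... | just r | _ = r , rootOf⇒HasRoot p eq

    IsForest⇒isForest : ∀ {p} → IsForest p → isForest Γ p ≡ true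
    IsForest⇒isForest {p} (forest uses roots) = cong₂ _∧_ (⇒allᵇ _ uses′) (⇒allᵇ _ roots′)
      where
      uses′ : ∀ i → maybe (λ j → arc j i) true (p i) ≡ true
      uses′ i with p i in pᵢ
      ... | nothing = refl
      ... | just j  = uses i j pᵢ
      roots′ : ∀ i → is-just (rootOf Γ p i) ≡ true
      roots′ i = cong is-just (HasRoot⇒rootOf p (proj₂ (roots i)))

    isForest-cong : ∀ {p q : ParentMap Γ} → p ≗ q → isForest Γ p ≡ isForest Γ q
    isForest-cong p≗q = cong₂ _∧_
      (allᵇ-cong (λ i → cong (maybe (λ j → arc j i) true) (p≗q i)))
      (allᵇ-cong (λ i → cong is-just (rootOf-cong p≗q i)))

    numArcs≡count : ∀ p → numArcs Γ p ≡ count (is-just ∘ p)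
    numArcs≡count p = length-filterᵇ-tabulate (is-just ∘ p) id

    numArcs-cong : ∀ {p q : ParentMap Γ} → p ≗ q → numArcs Γ p ≡ numArcs Γ q
    numArcs-cong {p} {q} p≗q = trans (numArcs≡count p) (trans (count-cong (cong is-just ∘ p≗q)) (sym (numArcs≡count q)))

    arcWeight : ParentMap Γ → Fin n → Carrier
    arcWeight p i = maybe (λ j → ε j i) 1# (p i)

    weight-cong : ∀ {p q : ParentMap Γ} → p ≗ q → weight Γ p ≡ weight Γ q
    weight-cong p≗q = ∏-cong (λ i → cong (maybe (λ j → ε j i) 1#) (p≗q i))

    weight-pos : ∀ {p} → UsesArcs p → 0# < weight Γ p
    weight-pos {p} uses = ∏-pos arcWeight-pos
      where
      arcWeight-pos : ∀ i → 0# < arcWeight p i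
      arcWeight-pos i with p i in pᵢ
      ... | nothing = 0<1
      ... | just j  = positive j i (uses i j pᵢ)

    _[_]≔_ : ParentMap Γ → Fin n → Maybe (Fin n) → ParentMap Γ
    p [ i ]≔ m = updateAt p i (const m)

    ≔-updates : ∀ (p : ParentMap Γ) i m → (p [ i ]≔ m) i ≡ m
    ≔-updates p i m = updateAt-updates i p

    ≔-others : ∀ (p : ParentMap Γ) i m y → ¬ y ≡ i → (p [ i ]≔ m) y ≡ p y
    ≔-others p i m y = updateAt-minimal y i p

    module AddArc {q p : ParentMap Γ} {i a : Fin n}
                  (qᵢ≡nothing : q i ≡ nothing) (pᵢ≡a : p i ≡ just a) (p≗q : ∀ y → ¬ y ≡ i → p y ≡ q y) where

      private
        q≗p : ∀ y → ¬ y ≡ i → q y ≡ p y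
        q≗p y y≢i = sym (p≗q y y≢i)

      rootWithin-removeArc : ∀ k z {r} → rootWithin Γ k p z ≡ just r →
                             rootWithin Γ k q z ≡ just r ⊎ (rootWithin Γ k q z ≡ just i × HasRoot p i r)
      rootWithin-removeArc k z eq with z ≟ i
      ... | yes refl = inj₂ (rootWithin-at-root k q z qᵢ≡nothing , reach k eq)
      ... | no z≢i with p z in pz
      ...   | nothing = inj₁ (trans (rootWithin-at-root k q z (trans (q≗p z z≢i) pz)) eq)
      rootWithin-removeArc (suc k) z eq | no z≢i | just y with rootWithin-removeArc k y eq
      ... | inj₁ eq′         = inj₁ (trans (rootWithin-step k q z (trans (q≗p z z≢i) pz)) eq′)
      ... | inj₂ (eq′ , i⇝r) = inj₂ (trans (rootWithin-step k q z (trans (q≗p z z≢i) pz)) eq′ , i⇝r)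

      HasRoot-removeArc : ∀ {z r} → HasRoot p z r → ¬ HasRoot p i r → HasRoot q z r
      HasRoot-removeArc {z} (reach k eq) i↛r with rootWithin-removeArc k z eq
      ... | inj₁ eq′       = reach k eq′
      ... | inj₂ (_ , i⇝r) = ⊥-elim (i↛r i⇝r)

      forest-removeArc : IsForest p → IsForest q
      forest-removeArc p-forest = forest uses chains-end
        where
        uses : UsesArcs q
        uses j b q≡b with j ≟ i
        ... | yes refl with () ← trans (sym q≡b) qᵢ≡nothing
        ... | no j≢i = uses-arcs p-forest j b (trans (p≗q j j≢i) q≡b)
        chains-end : Acyclic q
        chains-end z with has-roots p-forest z
        ... | r , reach k eq with rootWithin-removeArc k z eq
        ...   | inj₁ eq′       = r , reach k eq′
        ...   | inj₂ (eq′ , _) = i , reach k eq′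

      rootWithin-addArc-outside : ∀ k z {s} → rootWithin Γ k q z ≡ just s → ¬ s ≡ i → rootWithin Γ k p z ≡ just s
      rootWithin-addArc-outside k z eq s≢i with z ≟ i
      ... | yes refl = ⊥-elim (s≢i (just-injective (trans (sym eq) (rootWithin-at-root k q z qᵢ≡nothing))))
      ... | no z≢i with q z in qz
      ...   | nothing = trans (rootWithin-at-root k p z (trans (p≗q z z≢i) qz)) eq
      rootWithin-addArc-outside (suc k) z eq s≢i | no z≢i | just y =
        trans (rootWithin-step k p z (trans (p≗q z z≢i) qz)) (rootWithin-addArc-outside k y eq s≢i)

      HasRoot-addArc-outside : ∀ {z s} → HasRoot q z s → ¬ s ≡ i → HasRoot p z s
      HasRoot-addArc-outside {z} (reach k eq) s≢i = reach k (rootWithin-addArc-outside k z eq s≢i)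

      rootWithin-addArc-inside : ∀ k z → rootWithin Γ k q z ≡ just i → ∃[ t ] ∀ m → rootWithin Γ (t ℕ.+ m) p z ≡ rootWithin Γ m p i
      rootWithin-addArc-inside k z eq with z ≟ i
      ... | yes refl = 0 , λ m → refl
      ... | no z≢i with q z in qz
      ...   | nothing = ⊥-elim (z≢i (just-injective eq))
      rootWithin-addArc-inside (suc k) z eq | no z≢i | just y with rootWithin-addArc-inside k y eq
      ... | t , shift = suc t , λ m → trans (rootWithin-step (t ℕ.+ m) p z (trans (p≗q z z≢i) qz)) (shift m)

      HasRoot-addArc-inside : ∀ {z r} → HasRoot q a r → ¬ r ≡ i → HasRoot q z i → HasRoot p z r
      HasRoot-addArc-inside {z} (reach kₐ eqₐ) r≢i (reach k eq) with rootWithin-addArc-inside k z eq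
      ... | t , shift = reach (t ℕ.+ suc kₐ) (trans (shift (suc kₐ)) (trans (rootWithin-step kₐ p i pᵢ≡a) (rootWithin-addArc-outside kₐ a eqₐ r≢i)))

      forest-addArc : ∀ {r} → IsForest q → arc a i ≡ true → HasRoot q a r → ¬ r ≡ i → IsForest p
      forest-addArc {r} q-forest a→i a⇝r r≢i = forest uses chains-end
        where
        uses : UsesArcs p
        uses j b p≡b with j ≟ i
        ... | yes refl = subst (λ x → arc x j ≡ true) (just-injective (trans (sym pᵢ≡a) p≡b)) a→i
        ... | no j≢i   = uses-arcs q-forest j b (trans (sym (p≗q j j≢i)) p≡b)
        chains-end : Acyclic p
        chains-end z with has-roots q-forest z
        ... | s , z⇝s with s ≟ i
        ...   | yes refl = r , HasRoot-addArc-inside a⇝r r≢i z⇝s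
        ...   | no s≢i   = s , HasRoot-addArc-outside z⇝s s≢i

      rootWithin-cycle : ∀ k z {kz r} → rootWithin Γ kz q z ≡ just i → rootWithin Γ k p z ≡ just r →
                         ∃[ k′ ] k′ ℕ.< k × rootWithin Γ k′ p a ≡ just r
      rootWithin-cycle k z eq₁ eq with z ≟ i
      rootWithin-cycle zero    z eq₁ eq | yes refl with () ← trans (sym eq) (rootWithin-zero p z pᵢ≡a)
      rootWithin-cycle (suc k) z eq₁ eq | yes refl = k , ℕ.≤-refl , trans (sym (rootWithin-step k p z pᵢ≡a)) eq
      ... | no z≢i with q z in qz
      ...   | nothing = ⊥-elim (z≢i (just-injective eq₁))
      rootWithin-cycle zero z {suc kz} eq₁ eq | no z≢i | just y
        with () ← trans (sym eq) (rootWithin-zero p z (trans (p≗q z z≢i) qz))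
      rootWithin-cycle (suc k) z {suc kz} eq₁ eq | no z≢i | just y
        with k′ , k′<k , eq′ ← rootWithin-cycle k y eq₁ (trans (sym (rootWithin-step k p z (trans (p≗q z z≢i) qz))) eq)
        = k′ , ℕ.m<n⇒m<1+n k′<k , eq′

      forest-addArc⇒¬HasRoot : IsForest p → ¬ HasRoot q a i
      forest-addArc⇒¬HasRoot p-forest (reach _ a⇝ᵢ) with has-roots p-forest a
      ... | r , reach k a⇝r = <-rec (λ k → ¬ rootWithin Γ k p a ≡ just r) descend k a⇝r
        where
        descend : ∀ k → (∀ {k′} → k′ ℕ.< k → ¬ rootWithin Γ k′ p a ≡ just r) → ¬ rootWithin Γ k p a ≡ just r
        descend k shorter eq with rootWithin-cycle k a a⇝ᵢ eq
        ... | k′ , k′<k , eq′ = shorter k′<k eq′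

      numArcs-addArc : numArcs Γ p ≡ suc (numArcs Γ q)
      numArcs-addArc = begin
        numArcs Γ p               ≡⟨ numArcs≡count p ⟩
        count (is-just ∘ p)       ≡⟨ count-update (is-just ∘ q) (is-just ∘ p) i (cong is-just qᵢ≡nothing) (cong is-just pᵢ≡a)
                                                  (λ y y≢i → cong is-just (q≗p y y≢i)) ⟩
        suc (count (is-just ∘ q)) ≡⟨ cong suc (numArcs≡count q) ⟨
        suc (numArcs Γ q)         ∎

      weight-addArc : weight Γ p ≡ ε a i * weight Γ q
      weight-addArc = trans (∏-update (arcWeight q) (arcWeight p) i (cong (maybe (λ j → ε j i) 1#) qᵢ≡nothing)
                                       (λ y y≢i → cong (maybe (λ j → ε j y) 1#) (q≗p y y≢i)))
                            (cong (λ m → maybe (λ j → ε j i) 1# m * weight Γ q) pᵢ≡a)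

    module AttachAt (q : ParentMap Γ) (i a : Fin n) (qᵢ≡nothing : q i ≡ nothing) =
      AddArc qᵢ≡nothing (≔-updates q i (just a)) (≔-others q i (just a))

    data Walk : Fin n → Fin n → Set where
      []  : ∀ {x} → Walk x x
      _∷_ : ∀ {u x y} → arc u x ≡ true → Walk x y → Walk u y

    _∷ʳ_ : ∀ {u x y} → Walk u x → arc x y ≡ true → Walk u y
    []        ∷ʳ x→y = x→y ∷ []
    (e ∷ wlk) ∷ʳ x→y = e ∷ (wlk ∷ʳ x→y)

    rootWithin⇒Walk : ∀ {p} → UsesArcs p → ∀ k z {r} → rootWithin Γ k p z ≡ just r → Walk r z
    rootWithin⇒Walk {p} uses k z eq with p z in pz
    rootWithin⇒Walk uses k       z refl | nothing = []
    rootWithin⇒Walk uses (suc k) z eq   | just y  = rootWithin⇒Walk uses k y eq ∷ʳ uses z y pz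

    -- Sums over parent maps

    Extensional : ∀ {m} → ((Fin m → Maybe (Fin n)) → Carrier) → Set c
    Extensional f = ∀ {p q} → p ≗ q → f p ≡ f q

    ∑ᴹ : ∀ m → ((Fin m → Maybe (Fin n)) → Carrier) → Carrier
    ∑ᴹ m f = ∑ᴸ f (allMaps Γ m)

    ∑ᴾ : (ParentMap Γ → Carrier) → Carrier
    ∑ᴾ = ∑ᴹ n

    options : List (Maybe (Fin n))
    options = nothing ∷ List.map just (allFin n)

    ∑ᴹ-suc : ∀ m (f : (Fin (suc m) → Maybe (Fin n)) → Carrier) → Extensional f →
             ∑ᴹ (suc m) f ≡ ∑ᴸ (λ x → ∑ᴹ m (λ g → f (x Vector.∷ g))) options
    ∑ᴹ-suc m f f-ext = expand _ (λ x g → λ { zero → refl ; (suc k) → refl })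
      where
      -- allMaps builds its maps with a pattern lambda, which can be named only through unification.
      expand : (extend : Maybe (Fin n) → (Fin m → Maybe (Fin n)) → Fin (suc m) → Maybe (Fin n)) →
               (∀ x g → extend x g ≗ x Vector.∷ g) →
               ∑ᴸ f (List.concatMap (λ x → List.map (extend x) (allMaps Γ m)) options) ≡
               ∑ᴸ (λ x → ∑ᴹ m (λ g → f (x Vector.∷ g))) options
      expand extend extend≗∷ = trans (∑ᴸ-concatMap f (λ x → List.map (extend x) (allMaps Γ m)) options)
        (∑ᴸ-cong options (λ x → trans (∑ᴸ-map f (extend x) (allMaps Γ m)) (∑ᴸ-cong (allMaps Γ m) (f-ext ∘ extend≗∷ x))))

    _≟ᵐ_ : DecidableEquality (Maybe (Fin n))
    _≟ᵐ_ = ≡-dec _≟_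

    _≗ᵇ_ : ∀ {m} → (Fin m → Maybe (Fin n)) → (Fin m → Maybe (Fin n)) → Bool
    p ≗ᵇ q = allᵇ (λ x → does (p x ≟ᵐ q x))

    ≗ᵇ⇒≗ : ∀ {m} {p q : Fin m → Maybe (Fin n)} → p ≗ᵇ q ≡ true → p ≗ q
    ≗ᵇ⇒≗ {p = p} {q} p≗ᵇq x = does≡true⇒ (p x ≟ᵐ q x) (allᵇ⇒ _ p≗ᵇq x)

    ≗⇒≗ᵇ : ∀ {m} {p q : Fin m → Maybe (Fin n)} → p ≗ q → p ≗ᵇ q ≡ true
    ≗⇒≗ᵇ {p = p} {q} p≗q = ⇒allᵇ _ (λ x → dec-true (p x ≟ᵐ q x) (p≗q x))

    ≗ᵇ-congʳ : ∀ {m} (q : Fin m → Maybe (Fin n)) {p p′} → p ≗ p′ → q ≗ᵇ p ≡ q ≗ᵇ p′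
    ≗ᵇ-congʳ q p≗p′ = allᵇ-cong (λ x → cong (λ t → does (q x ≟ᵐ t)) (p≗p′ x))

    ∑ᴸ-options-select : ∀ y (G : Maybe (Fin n) → Carrier) → ∑ᴸ (λ x → if does (y ≟ᵐ x) then G x else 0#) options ≡ G y
    ∑ᴸ-options-select nothing  G = trans (cong (G nothing +_) (trans (∑ᴸ-map _ just (allFin n)) (∑ᴸ-zero (allFin n) (λ _ → refl))))
                                         (+-identityʳ _)
    ∑ᴸ-options-select (just j) G = trans (+-identityˡ _)
      (trans (∑ᴸ-map _ just (allFin n)) (trans (∑ᴸ-allFin (λ k → if does (j ≟ k) then G (just k) else 0#)) (∑-select j (G ∘ just))))

    ∑ᴹ-select : ∀ m (g : (Fin m → Maybe (Fin n)) → Carrier) → Extensional g → ∀ q → ∑ᴹ m (λ p → if q ≗ᵇ p then g p else 0#) ≡ g q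
    ∑ᴹ-select zero    g g-ext q = trans (+-identityʳ _) (g-ext (λ ()))
    ∑ᴹ-select (suc m) g g-ext q = begin
      ∑ᴹ (suc m) g↾q
        ≡⟨ ∑ᴹ-suc m g↾q g↾q-ext ⟩
      ∑ᴸ (λ x → ∑ᴹ m (λ p → g↾q (x Vector.∷ p))) options
        ≡⟨ ∑ᴸ-cong options select-tail ⟩
      ∑ᴸ (λ x → if does (q zero ≟ᵐ x) then g (x Vector.∷ (q ∘ suc)) else 0#) options
        ≡⟨ ∑ᴸ-options-select (q zero) (λ x → g (x Vector.∷ (q ∘ suc))) ⟩
      g (q zero Vector.∷ (q ∘ suc))
        ≡⟨ g-ext (λ { zero → refl ; (suc k) → refl }) ⟩
      g q ∎
      where
      g↾q : (Fin (suc m) → Maybe (Fin n)) → Carrier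
      g↾q p = if q ≗ᵇ p then g p else 0#
      g↾q-ext : Extensional g↾q
      g↾q-ext {p} {p′} p≗p′ rewrite ≗ᵇ-congʳ q p≗p′ | g-ext p≗p′ = refl
      select-tail : ∀ x → ∑ᴹ m (λ p → g↾q (x Vector.∷ p)) ≡ (if does (q zero ≟ᵐ x) then g (x Vector.∷ (q ∘ suc)) else 0#)
      select-tail x with does (q zero ≟ᵐ x)
      ... | true  = ∑ᴹ-select m (λ p → g (x Vector.∷ p)) (λ p≗p′ → g-ext (λ { zero → refl ; (suc k) → p≗p′ k })) (q ∘ suc)
      ... | false = ∑ᴸ-zero (allMaps Γ m) (λ _ → refl)

    reattach-condition : ∀ (p q : ParentMap Γ) i a →
      (is-nothing (q i) ∧ ((q [ i ]≔ just a) ≗ᵇ p)) ≡ (does (p i ≟ᵐ just a) ∧ ((p [ i ]≔ nothing) ≗ᵇ q))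
    reattach-condition p q i a = ⇔→≡ (mk⇔ detach attach)
      where
      detach : is-nothing (q i) ∧ ((q [ i ]≔ just a) ≗ᵇ p) ≡ true → does (p i ≟ᵐ just a) ∧ ((p [ i ]≔ nothing) ≗ᵇ q) ≡ true
      detach cond = cong₂ _∧_ (dec-true (p i ≟ᵐ just a) pᵢ≡a) (≗⇒≗ᵇ p-i≗q)
        where
        q+a≗p : (q [ i ]≔ just a) ≗ p
        q+a≗p = ≗ᵇ⇒≗ (∧-conicalʳ (is-nothing (q i)) _ cond)
        pᵢ≡a : p i ≡ just a
        pᵢ≡a = trans (sym (q+a≗p i)) (≔-updates q i _)
        p-i≗q : (p [ i ]≔ nothing) ≗ q
        p-i≗q j with j ≟ i
        ... | yes refl = trans (≔-updates p i _) (sym (is-nothing⇒≡nothing (∧-conicalˡ _ _ cond)))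
        ... | no j≢i   = trans (≔-others p i _ j j≢i) (trans (sym (q+a≗p j)) (≔-others q i _ j j≢i))
      attach : does (p i ≟ᵐ just a) ∧ ((p [ i ]≔ nothing) ≗ᵇ q) ≡ true → is-nothing (q i) ∧ ((q [ i ]≔ just a) ≗ᵇ p) ≡ true
      attach cond = cong₂ _∧_ (cong is-nothing qᵢ≡nothing) (≗⇒≗ᵇ q+a≗p)
        where
        p-i≗q : (p [ i ]≔ nothing) ≗ q
        p-i≗q = ≗ᵇ⇒≗ (∧-conicalʳ (does (p i ≟ᵐ just a)) _ cond)
        qᵢ≡nothing : q i ≡ nothing
        qᵢ≡nothing = trans (sym (p-i≗q i)) (≔-updates p i _)
        q+a≗p : (q [ i ]≔ just a) ≗ p
        q+a≗p j with j ≟ i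
        ... | yes refl = trans (≔-updates q i _) (sym (does≡true⇒ (p i ≟ᵐ just a) (∧-conicalˡ _ _ cond)))
        ... | no j≢i   = trans (≔-others q i _ j j≢i) (trans (sym (p-i≗q j)) (≔-others p i _ j j≢i))

    ∑ᴾ-by-parent : ∀ (F : ParentMap Γ → Carrier) → Extensional F → ∀ i →
      ∑ᴾ (λ p → if is-just (p i) then F p else 0#) ≡ ∑ (λ a → ∑ᴾ (λ q → if is-nothing (q i) then F (q [ i ]≔ just a) else 0#))
    ∑ᴾ-by-parent F F-ext i = sym (begin
      ∑ (λ a → ∑ᴾ (λ q → if is-nothing (q i) then F (q [ i ]≔ just a) else 0#))
        ≡⟨ ∑-cong (λ a → ∑ᴸ-cong maps (λ q → select-p a q (is-nothing (q i)))) ⟩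
      ∑ (λ a → ∑ᴾ (λ q → ∑ᴾ (λ p → Φ a q p)))
        ≡⟨ ∑-cong (λ a → ∑ᴸ-comm (Φ a) maps maps) ⟩
      ∑ (λ a → ∑ᴾ (λ p → ∑ᴾ (λ q → Φ a q p)))
        ≡⟨ ∑ᴸ-∑-comm (λ a p → ∑ᴾ (λ q → Φ a q p)) maps ⟨
      ∑ᴾ (λ p → ∑ (λ a → ∑ᴾ (λ q → Φ a q p)))
        ≡⟨ ∑ᴸ-cong maps (λ p → trans (∑-cong (λ a → select-q p a)) (select-a p (p i))) ⟩
      ∑ᴾ (λ p → if is-just (p i) then F p else 0#) ∎)
      where
      maps : List (ParentMap Γ)
      maps = allMaps Γ n
      Φ : Fin n → ParentMap Γ → ParentMap Γ → Carrier
      Φ a q p = if is-nothing (q i) ∧ ((q [ i ]≔ just a) ≗ᵇ p) then F p else 0#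
      select-p : ∀ a q b → (if b then F (q [ i ]≔ just a) else 0#) ≡ ∑ᴾ (λ p → if b ∧ ((q [ i ]≔ just a) ≗ᵇ p) then F p else 0#)
      select-p a q true  = sym (∑ᴹ-select n F F-ext (q [ i ]≔ just a))
      select-p a q false = sym (∑ᴸ-zero maps (λ _ → refl))
      select-q : ∀ p a → ∑ᴾ (λ q → Φ a q p) ≡ (if does (p i ≟ᵐ just a) then F p else 0#)
      select-q p a = trans (∑ᴸ-cong maps (λ q → cong (λ b → if b then F p else 0#) (reattach-condition p q i a)))
                           (select-detached (does (p i ≟ᵐ just a)))
        where
        select-detached : ∀ b → ∑ᴾ (λ q → if b ∧ ((p [ i ]≔ nothing) ≗ᵇ q) then F p else 0#) ≡ (if b then F p else 0#)
        select-detached true  = ∑ᴹ-select n (λ _ → F p) (λ _ → refl) (p [ i ]≔ nothing)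
        select-detached false = ∑ᴸ-zero maps (λ _ → refl)
      select-a : ∀ p m → ∑ (λ a → if does (m ≟ᵐ just a) then F p else 0#) ≡ (if is-just m then F p else 0#)
      select-a p nothing  = ∑-0 n
      select-a p (just b) = ∑-select b (λ _ → F p)

    ∑ᴾ-pos : ∀ (g : ParentMap Γ → Carrier) → Extensional g → (∀ p → 0# ≤ g p) → ∀ q → 0# < g q → 0# < ∑ᴾ g
    ∑ᴾ-pos g g-ext 0≤g q 0<gq = subst (0# <_) (sym split)
      (pos+nonneg (subst (0# <_) (sym (∑ᴹ-select n g g-ext q)) 0<gq) (∑ᴸ-nonneg (allMaps Γ n) 0≤others))
      where
      others : ParentMap Γ → Carrier
      others p = if q ≗ᵇ p then 0# else g p
      0≤others : ∀ p → 0# ≤ others p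
      0≤others p with q ≗ᵇ p
      ... | true  = ≤-refl
      ... | false = 0≤g p
      split : ∑ᴾ g ≡ ∑ᴾ (λ p → if q ≗ᵇ p then g p else 0#) + ∑ᴾ others
      split = trans (∑ᴸ-cong (allMaps Γ n) split-at) (∑ᴸ-distrib-+ _ others (allMaps Γ n))
        where
        split-at : ∀ p → g p ≡ (if q ≗ᵇ p then g p else 0#) + others p
        split-at p with q ≗ᵇ p
        ... | true  = sym (+-identityʳ _)
        ... | false = sym (+-identityˡ _)

    -- The Kirchhoff matrix and harmonic vectors

    w-loop : ∀ i → w Γ i i ≡ 0#
    w-loop i rewrite loopless i = refl

    w-nonneg : ∀ k i → 0# ≤ w Γ k i
    w-nonneg k i with arc k i in k→i
    ... | true  = <⇒≤ (positive k i k→i)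
    ... | false = ≤-refl

    w-arc : ∀ {k i} → arc k i ≡ true → w Γ k i ≡ ε k i
    w-arc k→i rewrite k→i = refl

    w-noarc : ∀ {k i} → arc k i ≡ false → w Γ k i ≡ 0#
    w-noarc k↛i rewrite k↛i = refl

    kirchhoff-action : ∀ i (y : Fin n → Carrier) → ∑ (λ k → kirchhoff Γ i k * y k) ≡ ∑ (λ k → w Γ k i * (y i - y k))
    kirchhoff-action i y = begin
      ∑ (λ k → kirchhoff Γ i k * y k)
        ≡⟨ ∑-cong entry ⟩
      ∑ (λ k → (if does (i ≟ k) then D * y i else 0#) - w Γ k i * y k)
        ≡⟨ ∑-distrib-- _ (λ k → w Γ k i * y k) ⟩
      ∑ (λ k → if does (i ≟ k) then D * y i else 0#) - ∑ (λ k → w Γ k i * y k)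
        ≡⟨ cong (_- ∑ (λ k → w Γ k i * y k)) (∑-select i (λ _ → D * y i)) ⟩
      D * y i - ∑ (λ k → w Γ k i * y k)
        ≡⟨ cong (λ d → d * y i - ∑ (λ k → w Γ k i * y k)) D≡∑w ⟩
      ∑ (λ k → w Γ k i) * y i - ∑ (λ k → w Γ k i * y k)
        ≡⟨ cong (_- ∑ (λ k → w Γ k i * y k)) (*-distribʳ-∑ (y i) (λ k → w Γ k i)) ⟩
      ∑ (λ k → w Γ k i * y i) - ∑ (λ k → w Γ k i * y k)
        ≡⟨ ∑-distrib-- (λ k → w Γ k i * y i) (λ k → w Γ k i * y k) ⟨
      ∑ (λ k → w Γ k i * y i - w Γ k i * y k)
        ≡⟨ ∑-cong (λ k → x[y-z]≈xy-xz (w Γ k i) (y i) (y k)) ⟨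
      ∑ (λ k → w Γ k i * (y i - y k)) ∎
      where
      D : Carrier
      D = ∑ (λ k → if does (k ≟ i) then 0# else w Γ k i)
      D≡∑w : D ≡ ∑ (λ k → w Γ k i)
      D≡∑w = ∑-cong diagonal-free
        where
        diagonal-free : ∀ k → (if does (k ≟ i) then 0# else w Γ k i) ≡ w Γ k i
        diagonal-free k with k ≟ i
        ... | yes refl = sym (w-loop k)
        ... | no _     = refl
      entry : ∀ k → kirchhoff Γ i k * y k ≡ (if does (i ≟ k) then D * y i else 0#) - w Γ k i * y k
      entry k with i ≟ k
      ... | yes refl = sym (trans (cong (λ t → D * y i - t * y i) (w-loop i))
                                  (trans (cong (λ t → D * y i - t) (zeroˡ (y i))) (trans (cong (D * y i +_) -0#≈0#) (+-identityʳ _))))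
      ... | no _     = trans (sym (-‿distribˡ-* (w Γ k i) (y k))) (sym (+-identityˡ _))

    Harmonic : (Fin n → Carrier) → Set c
    Harmonic x = ∀ i → ∑ (λ k → kirchhoff Γ i k * x k) ≡ 0#

    harmonic-neg : ∀ {x} → Harmonic x → Harmonic (λ k → - x k)
    harmonic-neg {x} x-harmonic i = begin
      ∑ (λ k → kirchhoff Γ i k * - x k)     ≡⟨ ∑-cong (λ k → -‿distribʳ-* (kirchhoff Γ i k) (x k)) ⟨
      ∑ (λ k → - (kirchhoff Γ i k * x k))   ≡⟨ ∑-neg (λ k → kirchhoff Γ i k * x k) ⟩
      - ∑ (λ k → kirchhoff Γ i k * x k)     ≡⟨ cong -_ (x-harmonic i) ⟩
      - 0#                                  ≡⟨ -0#≈0# ⟩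
      0#                                    ∎

    harmonic-max-inneighbour : ∀ {x i k} → Harmonic x → (∀ j → x j ≤ x i) → arc k i ≡ true → x k ≡ x i
    harmonic-max-inneighbour {x} {i} {k} x-harmonic i-max k→i =
      sym (x∙y⁻¹≈ε⇒x≈y (x i) (x k) (*-cancelˡ-0 wₖᵢ≢0 (∑-nonneg-≡0 0≤term ∑term≡0 k)))
      where
      wₖᵢ≢0 : ¬ w Γ k i ≡ 0#
      wₖᵢ≢0 = pos⇒≢0 (subst (0# <_) (sym (w-arc k→i)) (positive k i k→i))
      0≤term : ∀ k → 0# ≤ w Γ k i * (x i - x k)
      0≤term k = nonneg*nonneg (w-nonneg k i) (x≤y⇒0≤y-x (i-max k))
      ∑term≡0 : ∑ (λ k → w Γ k i * (x i - x k)) ≡ 0#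
      ∑term≡0 = trans (sym (kirchhoff-action i x)) (x-harmonic i)

    harmonic-max-root : ∀ {p x m} → UsesArcs p → Harmonic x → (∀ j → x j ≤ x m) →
                        ∀ k z {r} → rootWithin Γ k p z ≡ just r → x z ≡ x m → x r ≡ x m
    harmonic-max-root {p} {x} {m} uses x-harmonic m-max k z eq xz≡max with p z in pz
    harmonic-max-root                 uses x-harmonic m-max k       z refl xz≡max | nothing = xz≡max
    harmonic-max-root {x = x} uses x-harmonic m-max (suc k) z eq xz≡max | just y =
      harmonic-max-root uses x-harmonic m-max k y eq
        (trans (harmonic-max-inneighbour x-harmonic (λ j → subst (x j ≤_) (sym xz≡max) (m-max j)) (uses z y pz)) xz≡max)

    harmonic-≤0 : ∀ {p x} → IsForest p → Harmonic x → (∀ r → p r ≡ nothing → x r ≡ 0#) → ∀ i → x i ≤ 0#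
    harmonic-≤0 {p} {x} p-forest x-harmonic x-roots i with argmax i x
    ... | m , m-max with has-roots p-forest m
    ...   | r , reach k m⇝r =
      subst (x i ≤_) (trans (sym (harmonic-max-root (uses-arcs p-forest) x-harmonic m-max k m m⇝r refl)) (x-roots r (rootWithin-root k p m m⇝r)))
            (m-max i)

    harmonic-zero : ∀ {p x} → IsForest p → Harmonic x → (∀ r → p r ≡ nothing → x r ≡ 0#) → ∀ i → x i ≡ 0#
    harmonic-zero {p} {x} p-forest x-harmonic x-roots i = antisym (harmonic-≤0 p-forest x-harmonic x-roots i)
      (subst₂ _≤_ -0#≈0# (-‿involutive (x i))
        (neg-mono-≤ (harmonic-≤0 p-forest (harmonic-neg x-harmonic) (λ r pᵣ → trans (cong -_ (x-roots r pᵣ)) -0#≈0#) i)))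

    -- Maximum out forests

    module MaximumForests (N : ℕ) (maximum : ∀ q → IsForest q → numArcs Γ q ℕ.≤ N) where

      IsMaximumForest : ParentMap Γ → Set
      IsMaximumForest p = IsForest p × numArcs Γ p ≡ N

      isMaximumForest : ParentMap Γ → Bool
      isMaximumForest p = isForest Γ p ∧ does (numArcs Γ p ℕ.≟ N)

      isMaximumForest⇒ : ∀ {p} → isMaximumForest p ≡ true → IsMaximumForest p
      isMaximumForest⇒ {p} max = isForest⇒IsForest (∧-conicalˡ _ _ max) , does≡true⇒ (numArcs Γ p ℕ.≟ N) (∧-conicalʳ (isForest Γ p) _ max)

      ⇒isMaximumForest : ∀ {p} → IsMaximumForest p → isMaximumForest p ≡ true
      ⇒isMaximumForest {p} (p-forest , arcs≡N) = cong₂ _∧_ (IsForest⇒isForest p-forest) (dec-true (numArcs Γ p ℕ.≟ N) arcs≡N)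

      isMaximumForest-cong : ∀ {p q} → p ≗ q → isMaximumForest p ≡ isMaximumForest q
      isMaximumForest-cong p≗q = cong₂ _∧_ (isForest-cong p≗q) (cong (λ k → does (k ℕ.≟ N)) (numArcs-cong p≗q))

      no-forest-beyond : ∀ {p} → IsForest p → ¬ numArcs Γ p ≡ suc N
      no-forest-beyond {p} p-forest arcs≡1+N = ℕ.<-irrefl refl (subst (ℕ._≤ N) arcs≡1+N (maximum p p-forest))

      -- Otherwise the arc k → i could be added to p.
      maximum-inneighbour-of-root : ∀ {p i k} → IsMaximumForest p → p i ≡ nothing → arc k i ≡ true → rootOf Γ p k ≡ just i
      maximum-inneighbour-of-root {p} {i} {k} (p-forest , arcs≡N) pᵢ≡nothing k→i with has-roots p-forest k
      ... | r , k⇝r with r ≟ i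
      ...   | yes refl = HasRoot⇒rootOf p k⇝r
      ...   | no r≢i   = ⊥-elim (no-forest-beyond (forest-addArc p-forest k→i k⇝r r≢i) (trans numArcs-addArc (cong suc arcs≡N)))
        where open AttachAt p i k pᵢ≡nothing

      rehang : ∀ {p u x y s} → IsMaximumForest p → arc u x ≡ true → p x ≡ just y → HasRoot p u s → ¬ HasRoot p x s →
               ∃[ p₂ ] IsMaximumForest p₂ × HasRoot p₂ x s × (∀ z → ¬ z ≡ x → p₂ z ≡ p z)
      rehang {p} {u} {x} {y} {s} (p-forest , arcs≡N) u→x pₓ≡y u⇝s x↛s =
        q [ x ]≔ just u , (p₂-forest , arcs₂≡N) , x⇝s , agrees
        where
        q : ParentMap Γ
        q = p [ x ]≔ nothing
        p≗q : ∀ z → ¬ z ≡ x → p z ≡ q z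
        p≗q z z≢x = sym (≔-others p x nothing z z≢x)
        module Detach = AddArc (≔-updates p x nothing) pₓ≡y p≗q
        module Attach = AttachAt q x u (≔-updates p x nothing)
        q-forest : IsForest q
        q-forest = Detach.forest-removeArc p-forest
        u⇝s-in-q : HasRoot q u s
        u⇝s-in-q = Detach.HasRoot-removeArc u⇝s x↛s
        s≢x : ¬ s ≡ x
        s≢x refl with () ← trans (sym pₓ≡y) (HasRoot⇒root u⇝s)
        p₂-forest : IsForest (q [ x ]≔ just u)
        p₂-forest = Attach.forest-addArc q-forest u→x u⇝s-in-q s≢x
        arcs₂≡N : numArcs Γ (q [ x ]≔ just u) ≡ N
        arcs₂≡N = trans Attach.numArcs-addArc (trans (sym Detach.numArcs-addArc) arcs≡N)
        x⇝s : HasRoot (q [ x ]≔ just u) x s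
        x⇝s = Attach.HasRoot-addArc-inside u⇝s-in-q s≢x (HasRoot-self (≔-updates p x nothing))
        agrees : ∀ z → ¬ z ≡ x → (q [ x ]≔ just u) z ≡ p z
        agrees z z≢x = trans (≔-others q x (just u) z z≢x) (≔-others p x nothing z z≢x)

      -- If u lay in a tree with root s ≢ r, rehanging x below u would give a maximum forest, still
      -- with root r, in which x has root s.
      arc-into-tree : ∀ {p u x r} → IsMaximumForest p → arc u x ≡ true → p r ≡ nothing →
                      (∀ {p₂} → IsMaximumForest p₂ → p₂ r ≡ nothing → HasRoot p₂ x r) → HasRoot p u r
      arc-into-tree {p} {u} {x} {r} p-max u→x pᵣ≡nothing x⇝r-in with x ≟ r
      ... | yes refl = rootOf⇒HasRoot p (maximum-inneighbour-of-root p-max pᵣ≡nothing u→x)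
      ... | no x≢r with has-roots (proj₁ p-max) u
      ...   | s , u⇝s with s ≟ r
      ...     | yes refl = u⇝s
      ...     | no s≢r with p x in pₓ
      ...       | nothing = ⊥-elim (x≢r (HasRoot-unique (HasRoot-self pₓ) (x⇝r-in p-max pᵣ≡nothing)))
      ...       | just y with rehang p-max u→x pₓ u⇝s (λ x⇝s → s≢r (HasRoot-unique x⇝s (x⇝r-in p-max pᵣ≡nothing)))
      ...         | p₂ , p₂-max , x⇝s , agrees =
        ⊥-elim (s≢r (HasRoot-unique x⇝s (x⇝r-in p₂-max (trans (agrees r (x≢r ∘ sym)) pᵣ≡nothing))))

      walk-to-root : ∀ {u r} → Walk u r → ∀ {p} → IsMaximumForest p → p r ≡ nothing → rootOf Γ p u ≡ just r
      walk-to-root []           {p} p-max pᵣ≡nothing = rootOf-root p pᵣ≡nothing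
      walk-to-root (u→x ∷ walk) {p} p-max pᵣ≡nothing = HasRoot⇒rootOf p
        (arc-into-tree p-max u→x pᵣ≡nothing (λ {p₂} p₂-max p₂ᵣ≡nothing → rootOf⇒HasRoot p₂ (walk-to-root walk p₂-max p₂ᵣ≡nothing)))

      rootIs : Fin n → Maybe (Fin n) → Bool
      rootIs j m = maybe (λ r → does (r ≟ j)) false m

      rootIs-self : ∀ j → rootIs j (just j) ≡ true
      rootIs-self j = dec-true (j ≟ j) refl

      rootIs-other : ∀ {r j} → ¬ r ≡ j → rootIs j (just r) ≡ false
      rootIs-other {r} {j} r≢j = dec-false (r ≟ j) r≢j

      rootIs⇒ : ∀ {j} m → rootIs j m ≡ true → m ≡ just j
      rootIs⇒ {j} (just r) rootIs≡true = cong just (does≡true⇒ (r ≟ j) rootIs≡true)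

      treeWeight : Fin n → Fin n → ParentMap Γ → Carrier
      treeWeight j x p = if isMaximumForest p then (if rootIs j (rootOf Γ p x) then weight Γ p else 0#) else 0#

      treeWeight-ext : ∀ j x → Extensional (treeWeight j x)
      treeWeight-ext j x p≗q rewrite isMaximumForest-cong p≗q | rootOf-cong p≗q x | weight-cong p≗q = refl

      isSubmaximumForest : ParentMap Γ → Bool
      isSubmaximumForest q = isForest Γ q ∧ does (suc (numArcs Γ q) ℕ.≟ N)

      reattachedRoot : Fin n → ParentMap Γ → Fin n → Fin n → Maybe (Fin n)
      reattachedRoot i q a x = if rootIs i (rootOf Γ q x) then rootOf Γ q a else rootOf Γ q x

      attachedWeight : Fin n → Fin n → Fin n → ParentMap Γ → Fin n → Carrier
      attachedWeight i j x q a =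
        if rootIs i (rootOf Γ q a) then 0# else (if rootIs j (reattachedRoot i q a x) then w Γ a i * weight Γ q else 0#)

      reattachedWeight : Fin n → Fin n → Fin n → ParentMap Γ → Fin n → Carrier
      reattachedWeight i j x q a = if isSubmaximumForest q then attachedWeight i j x q a else 0#

      module _ (i j x : Fin n) (q : ParentMap Γ) (a : Fin n) (qᵢ≡nothing : q i ≡ nothing) where
        open AttachAt q i a qᵢ≡nothing

        private
          p : ParentMap Γ
          p = q [ i ]≔ just a

        treeWeight-reattach-forest : IsForest p → treeWeight j x p ≡ reattachedWeight i j x q a
        treeWeight-reattach-forest p-forest = begin
          treeWeight j x p
            ≡⟨ cong₂ (λ b t → if b then t else 0#) guard
                     (cong₂ (λ b t → if b then t else 0#) (cong (rootIs j) rootOf-reattached) weight-reattached) ⟩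
          (if isSubmaximumForest q then reattached else 0#)
            ≡⟨ cong (λ b → if isSubmaximumForest q then (if b then 0# else reattached) else 0#) a-outside-i ⟨
          reattachedWeight i j x q a ∎
          where
          reattached : Carrier
          reattached = if rootIs j (reattachedRoot i q a x) then w Γ a i * weight Γ q else 0#
          q-forest : IsForest q
          q-forest = forest-removeArc p-forest
          r : Fin n
          r = proj₁ (has-roots q-forest a)
          a⇝r : HasRoot q a r
          a⇝r = proj₂ (has-roots q-forest a)
          r≢i : ¬ r ≡ i
          r≢i r≡i = forest-addArc⇒¬HasRoot p-forest (subst (HasRoot q a) r≡i a⇝r)
          a-outside-i : rootIs i (rootOf Γ q a) ≡ false
          a-outside-i = trans (cong (rootIs i) (HasRoot⇒rootOf q a⇝r)) (rootIs-other r≢i)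
          guard : isMaximumForest p ≡ isSubmaximumForest q
          guard = cong₂ _∧_ (trans (IsForest⇒isForest p-forest) (sym (IsForest⇒isForest q-forest)))
                            (cong (λ k → does (k ℕ.≟ N)) numArcs-addArc)
          weight-reattached : weight Γ p ≡ w Γ a i * weight Γ q
          weight-reattached = trans weight-addArc (cong (_* weight Γ q) (sym (w-arc (uses-arcs p-forest i a (≔-updates q i (just a))))))
          rootOf-reattached : rootOf Γ p x ≡ reattachedRoot i q a x
          rootOf-reattached with has-roots q-forest x
          ... | s , x⇝s with s ≟ i
          ...   | yes refl rewrite HasRoot⇒rootOf q x⇝s | rootIs-self s =
            trans (HasRoot⇒rootOf p (HasRoot-addArc-inside a⇝r r≢i x⇝s)) (sym (HasRoot⇒rootOf q a⇝r))
          ...   | no s≢i rewrite HasRoot⇒rootOf q x⇝s | rootIs-other s≢i = HasRoot⇒rootOf p (HasRoot-addArc-outside x⇝s s≢i)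

        treeWeight-reattach-nonforest : isForest Γ p ≡ false → treeWeight j x p ≡ reattachedWeight i j x q a
        treeWeight-reattach-nonforest p-nonforest =
          trans (if-guard-0 (isMaximumForest p) p-max⇒0)
                (sym (if-guard-0 (isSubmaximumForest q) (attached≡0 ∘ isForest⇒IsForest ∘ ∧-conicalˡ (isForest Γ q) _)))
          where
          p-max⇒0 : isMaximumForest p ≡ true → (if rootIs j (rootOf Γ p x) then weight Γ p else 0#) ≡ 0#
          p-max⇒0 p-max with () ← trans (sym p-nonforest) (∧-conicalˡ (isForest Γ p) _ p-max)
          attached≡0 : IsForest q → attachedWeight i j x q a ≡ 0#
          attached≡0 q-forest with has-roots q-forest a
          ... | r , a⇝r with r ≟ i
          ...   | yes refl rewrite HasRoot⇒rootOf q a⇝r | rootIs-self r = refl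
          ...   | no r≢i with arc a i in a→i
          ...     | true with () ← trans (sym (IsForest⇒isForest (forest-addArc q-forest a→i a⇝r r≢i))) p-nonforest
          ...     | false rewrite HasRoot⇒rootOf q a⇝r | rootIs-other r≢i = if-guard-0 _ (λ _ → zeroˡ (weight Γ q))

        treeWeight-reattach : treeWeight j x p ≡ reattachedWeight i j x q a
        treeWeight-reattach = by-cases (isForest Γ p) refl
          where
          by-cases : ∀ b → isForest Γ p ≡ b → treeWeight j x p ≡ reattachedWeight i j x q a
          by-cases true  p-forest    = treeWeight-reattach-forest (isForest⇒IsForest p-forest)
          by-cases false p-nonforest = treeWeight-reattach-nonforest p-nonforest

      -- The contribution of the forest p to (L J) i j, cf. kirchhoff-action.
      flux : Fin n → Fin n → ParentMap Γ → Carrier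
      flux i j p = ∑ (λ k → w Γ k i * (treeWeight j i p - treeWeight j k p))

      flux-ext : ∀ i j → Extensional (flux i j)
      flux-ext i j p≗q = ∑-cong (λ k → cong₂ (λ s t → w Γ k i * (s - t)) (treeWeight-ext j i p≗q) (treeWeight-ext j k p≗q))

      flux-at-root : ∀ i j p → p i ≡ nothing → flux i j p ≡ 0#
      flux-at-root i j p pᵢ≡nothing = ∑-zero no-exchange
        where
        same-tree : ∀ k → arc k i ≡ true → ∀ b → isMaximumForest p ≡ b →
                    (if b then (if rootIs j (rootOf Γ p i) then weight Γ p else 0#) else 0#) ≡
                    (if b then (if rootIs j (rootOf Γ p k) then weight Γ p else 0#) else 0#)
        same-tree k k→i true  p-max = cong (λ m → if rootIs j m then weight Γ p else 0#)
          (trans (rootOf-root p pᵢ≡nothing) (sym (maximum-inneighbour-of-root (isMaximumForest⇒ p-max) pᵢ≡nothing k→i)))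
        same-tree k k→i false _     = refl
        no-exchange : ∀ k → w Γ k i * (treeWeight j i p - treeWeight j k p) ≡ 0#
        no-exchange k = by-arc (arc k i) refl
          where
          by-arc : ∀ b → arc k i ≡ b → w Γ k i * (treeWeight j i p - treeWeight j k p) ≡ 0#
          by-arc false k↛i = trans (cong (_* (treeWeight j i p - treeWeight j k p)) (w-noarc k↛i)) (zeroˡ _)
          by-arc true  k→i = trans (cong (λ t → w Γ k i * (treeWeight j i p - t)) (sym (same-tree k k→i (isMaximumForest p) refl)))
                                   (trans (cong (w Γ k i *_) (-‿inverseʳ _)) (zeroʳ _))

      reattached-flux-cancels : ∀ i j q → q i ≡ nothing → ∑ (λ a → flux i j (q [ i ]≔ just a)) ≡ 0#
      reattached-flux-cancels i j q qᵢ≡nothing = begin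
        ∑ (λ a → flux i j (q [ i ]≔ just a))
          ≡⟨ ∑-cong (λ a → ∑-cong (λ k → cong₂ (λ s t → w Γ k i * (s - t))
                                               (treeWeight-reattach i j i q a qᵢ≡nothing)
                                               (treeWeight-reattach i j k q a qᵢ≡nothing))) ⟩
        ∑ (λ a → ∑ (λ k → w Γ k i * (reattachedWeight i j i q a - reattachedWeight i j k q a)))
          ≡⟨ by-cases (isSubmaximumForest q) refl ⟩
        0# ∎
        where
        ω : Carrier
        ω = weight Γ q
        α β : Fin n → Bool
        α x = rootIs i (rootOf Γ q x)
        β x = rootIs j (rootOf Γ q x)
        attached : Fin n → Bool → Carrier
        attached a γ = if α a then 0# else (if γ then w Γ a i * ω else 0#)
        S : Fin n → Fin n → Carrier
        S a k = if α a ∨ α k then 0# else (if β a then w Γ k i * (w Γ a i * ω) else 0#)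
        by-cases : ∀ b → isSubmaximumForest q ≡ b →
                   ∑ (λ a → ∑ (λ k → w Γ k i * (reattachedWeight i j i q a - reattachedWeight i j k q a))) ≡ 0#
        by-cases false q-nonsub = ∑-zero λ a → ∑-zero λ k →
          trans (cong₂ (λ s t → w Γ k i * (s - t)) (not-submaximal i a) (not-submaximal k a))
                (trans (cong (w Γ k i *_) (-‿inverseʳ 0#)) (zeroʳ _))
          where
          not-submaximal : ∀ x a → reattachedWeight i j x q a ≡ 0#
          not-submaximal x a = cong (λ g → if g then attachedWeight i j x q a else 0#) q-nonsub
        by-cases true q-sub = trans (∑-cong (λ a → ∑-cong (λ k → exchange a k))) (∑-antisymmetric S)
          where
          submaximal : ∀ x a → reattachedWeight i j x q a ≡ attachedWeight i j x q a
          submaximal x a = cong (λ g → if g then attachedWeight i j x q a else 0#) q-sub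
          αᵢ : α i ≡ true
          αᵢ = trans (cong (rootIs i) (rootOf-root q qᵢ≡nothing)) (rootIs-self i)
          exchange : ∀ a k → w Γ k i * (reattachedWeight i j i q a - reattachedWeight i j k q a) ≡ S a k - S k a
          exchange a k = begin
            w Γ k i * (reattachedWeight i j i q a - reattachedWeight i j k q a)
              ≡⟨ cong₂ (λ s t → w Γ k i * (s - t)) (submaximal i a) (submaximal k a) ⟩
            w Γ k i * (attachedWeight i j i q a - attachedWeight i j k q a)
              ≡⟨ cong₂ (λ γᵢ γₖ → w Γ k i * (attached a γᵢ - attached a γₖ))
                       (cong (λ b → rootIs j (if b then rootOf Γ q a else rootOf Γ q i)) αᵢ)
                       (if-float (rootIs j) (α k)) ⟩
            w Γ k i * (attached a (β a) - attached a (if α k then β a else β k))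
              ≡⟨ exchange-antisymmetric (α a) (α k) (β a) (β k) (w Γ a i) (w Γ k i) ω ⟩
            S a k - S k a ∎

      treeWeight-harmonic : ∀ i j → ∑ (λ k → kirchhoff Γ i k * ∑ᴾ (treeWeight j k)) ≡ 0#
      treeWeight-harmonic i j = begin
        ∑ (λ k → kirchhoff Γ i k * ∑ᴾ (treeWeight j k))
          ≡⟨ kirchhoff-action i (λ k → ∑ᴾ (treeWeight j k)) ⟩
        ∑ (λ k → w Γ k i * (∑ᴾ (treeWeight j i) - ∑ᴾ (treeWeight j k)))
          ≡⟨ ∑-cong (λ k → trans (cong (w Γ k i *_) (sym (∑ᴸ-distrib-- (treeWeight j i) (treeWeight j k) maps)))
                                 (*-distribˡ-∑ᴸ (w Γ k i) _ maps)) ⟩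
        ∑ (λ k → ∑ᴾ (λ p → w Γ k i * (treeWeight j i p - treeWeight j k p)))
          ≡⟨ ∑ᴸ-∑-comm (λ k p → w Γ k i * (treeWeight j i p - treeWeight j k p)) maps ⟨
        ∑ᴾ (flux i j)
          ≡⟨ trans (∑ᴸ-cong maps split) (∑ᴸ-distrib-+ rooted nonrooted maps) ⟩
        ∑ᴾ rooted + ∑ᴾ nonrooted
          ≡⟨ cong₂ _+_ (∑ᴸ-zero maps rooted≡0) (∑ᴾ-by-parent (flux i j) (flux-ext i j) i) ⟩
        0# + ∑ (λ a → ∑ᴾ (λ q → if is-nothing (q i) then flux i j (q [ i ]≔ just a) else 0#))
          ≡⟨ +-identityˡ _ ⟩
        ∑ (λ a → ∑ᴾ (λ q → if is-nothing (q i) then flux i j (q [ i ]≔ just a) else 0#))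
          ≡⟨ ∑ᴸ-∑-comm (λ a q → if is-nothing (q i) then flux i j (q [ i ]≔ just a) else 0#) maps ⟨
        ∑ᴾ (λ q → ∑ (λ a → if is-nothing (q i) then flux i j (q [ i ]≔ just a) else 0#))
          ≡⟨ ∑ᴸ-zero maps (λ q → cancels q (q i) refl) ⟩
        0# ∎
        where
        maps : List (ParentMap Γ)
        maps = allMaps Γ n
        rooted nonrooted : ParentMap Γ → Carrier
        rooted    p = if is-nothing (p i) then flux i j p else 0#
        nonrooted p = if is-just (p i) then flux i j p else 0#
        split : ∀ p → flux i j p ≡ rooted p + nonrooted p
        split p with p i
        ... | nothing = sym (+-identityʳ _)
        ... | just _  = sym (+-identityˡ _)
        rooted≡0 : ∀ p → rooted p ≡ 0#
        rooted≡0 p = if-guard-0 (is-nothing (p i)) (flux-at-root i j p ∘ is-nothing⇒≡nothing)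
        cancels : ∀ q m → q i ≡ m → ∑ (λ a → if is-nothing m then flux i j (q [ i ]≔ just a) else 0#) ≡ 0#
        cancels q nothing  qᵢ≡nothing = reattached-flux-cancels i j q qᵢ≡nothing
        cancels q (just _) _          = ∑-0 n

      forestWeight : ParentMap Γ → Carrier
      forestWeight p = if isMaximumForest p then weight Γ p else 0#

      forestWeight-ext : Extensional forestWeight
      forestWeight-ext p≗q rewrite isMaximumForest-cong p≗q | weight-cong p≗q = refl

      εset-𝓕 : εset Γ (𝓕 Γ N) ≡ ∑ᴾ forestWeight
      εset-𝓕 = ∑ᴸ-filterᵇ _ (weight Γ) (allMaps Γ n)

      εset-𝓕→ : ∀ j x → εset Γ (𝓕→ Γ N j x) ≡ ∑ᴾ (treeWeight j x)
      εset-𝓕→ j x = trans (∑ᴸ-filterᵇ _ (weight Γ) (𝓕 Γ N)) (∑ᴸ-filterᵇ _ _ (allMaps Γ n))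

      guarded-weight-nonneg : ∀ p b → (b ≡ true → IsMaximumForest p) → 0# ≤ (if b then weight Γ p else 0#)
      guarded-weight-nonneg p true  max = <⇒≤ (weight-pos (uses-arcs (proj₁ (max refl))))
      guarded-weight-nonneg p false _   = ≤-refl

      treeWeight-nonneg : ∀ j x p → 0# ≤ treeWeight j x p
      treeWeight-nonneg j x p with isMaximumForest p in p-max
      ... | true  = guarded-weight-nonneg p (rootIs j (rootOf Γ p x)) (λ _ → isMaximumForest⇒ p-max)
      ... | false = ≤-refl

      forestWeight-maximum : ∀ {p} → IsMaximumForest p → forestWeight p ≡ weight Γ p
      forestWeight-maximum p-max rewrite ⇒isMaximumForest p-max = refl

      treeWeight-maximum : ∀ {p j x} → IsMaximumForest p → rootOf Γ p x ≡ just j → treeWeight j x p ≡ weight Γ p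
      treeWeight-maximum {j = j} p-max x⇝j rewrite ⇒isMaximumForest p-max | x⇝j | rootIs-self j = refl

      module _ {p₀ : ParentMap Γ} (p₀-max : IsMaximumForest p₀) where

        ∑forestWeight-pos : 0# < ∑ᴾ forestWeight
        ∑forestWeight-pos = ∑ᴾ-pos forestWeight forestWeight-ext (λ p → guarded-weight-nonneg p (isMaximumForest p) isMaximumForest⇒) p₀
          (subst (0# <_) (sym (forestWeight-maximum p₀-max)) (weight-pos (uses-arcs (proj₁ p₀-max))))

        ∑treeWeight-root-pos : ∀ {r} → p₀ r ≡ nothing → 0# < ∑ᴾ (treeWeight r r)
        ∑treeWeight-root-pos {r} p₀ᵣ≡nothing = ∑ᴾ-pos (treeWeight r r) (treeWeight-ext r r) (treeWeight-nonneg r r) p₀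
          (subst (0# <_) (sym (treeWeight-maximum p₀-max (rootOf-root p₀ p₀ᵣ≡nothing))) (weight-pos (uses-arcs (proj₁ p₀-max))))

        ∑treeWeight-between-roots : ∀ {r r′} → p₀ r ≡ nothing → p₀ r′ ≡ nothing → ¬ r ≡ r′ → ∑ᴾ (treeWeight r r′) ≡ 0#
        ∑treeWeight-between-roots {r} {r′} p₀ᵣ≡nothing p₀ᵣ′≡nothing r≢r′ = ∑ᴸ-zero (allMaps Γ n) λ f →
          if-guard-0 (isMaximumForest f) λ f-max → if-guard-0 (rootIs r (rootOf Γ f r′)) λ r′-under-r →
            ⊥-elim (r≢r′ (just-injective (trans (sym (rootOf-root p₀ p₀ᵣ≡nothing))
              (walk-to-root (rootWithin⇒Walk (uses-arcs (proj₁ (isMaximumForest⇒ f-max))) n r′ (rootIs⇒ _ r′-under-r)) p₀-max p₀ᵣ′≡nothing))))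

    -- The two ranks

    module Ranks (v : ℕ) (dimension : IsForestDimension Γ v) where

      p₀ : ParentMap Γ
      p₀ = proj₁ dimension

      p₀-forest : IsForest p₀
      p₀-forest = isForest⇒IsForest (proj₁ (proj₂ dimension))

      module Nonroots = Enumeration (is-just ∘ p₀)
      module Roots    = Enumeration (is-nothing ∘ p₀)

      nonroots+roots≡n : numArcs Γ p₀ ℕ.+ List.length Roots.selected ≡ n
      nonroots+roots≡n = trans (length-filterᵇ-complement (is-just ∘ p₀) (allFin n)) (List.length-tabulate id)

      #roots≡v : List.length Roots.selected ≡ v
      #roots≡v = begin
        List.length Roots.selected                                ≡⟨ ℕ.m+n∸m≡n (numArcs Γ p₀) (List.length Roots.selected) ⟨
        numArcs Γ p₀ ℕ.+ List.length Roots.selected ℕ.∸ numArcs Γ p₀ ≡⟨ cong (ℕ._∸ numArcs Γ p₀) nonroots+roots≡n ⟩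
        numRoots Γ p₀                                             ≡⟨ proj₁ (proj₂ (proj₂ dimension)) ⟩
        v                                                         ∎

      #nonroots≡n∸v : numArcs Γ p₀ ≡ n ℕ.∸ v
      #nonroots≡n∸v = begin
        numArcs Γ p₀                                              ≡⟨ ℕ.m+n∸n≡m (numArcs Γ p₀) (List.length Roots.selected) ⟨
        numArcs Γ p₀ ℕ.+ List.length Roots.selected ℕ.∸ List.length Roots.selected ≡⟨ cong₂ ℕ._∸_ nonroots+roots≡n #roots≡v ⟩
        n ℕ.∸ v                                                   ∎

      maximum : ∀ q → IsForest q → numArcs Γ q ℕ.≤ n ℕ.∸ v
      maximum q q-forest = subst (numArcs Γ q ℕ.≤_) #nonroots≡n∸v (proj₂ (proj₂ (proj₂ dimension)) q (IsForest⇒isForest q-forest))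

      open MaximumForests (n ℕ.∸ v) maximum

      p₀-max : IsMaximumForest p₀
      p₀-max = p₀-forest , #nonroots≡n∸v

      nonroot≢root : ∀ k {r} → p₀ r ≡ nothing → ¬ Nonroots.enumerate k ≡ r
      nonroot≢root k p₀ᵣ≡nothing refl with () ← trans (sym (Nonroots.enumerate-sound k)) (cong is-just p₀ᵣ≡nothing)

      root : ∀ s → p₀ (Roots.enumerate s) ≡ nothing
      root s with p₀ (Roots.enumerate s) | Roots.enumerate-sound s
      ... | nothing | _ = refl

      kirchhoff-nonroot-columns-independent : LinIndepCols (kirchhoff Γ) Nonroots.enumerate
      kirchhoff-nonroot-columns-independent a La≡0 k = trans (sym x-at-nonroot) (harmonic-zero p₀-forest x-harmonic x-roots (η k))
        where
        η : Fin (numArcs Γ p₀) → Fin n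
        η = Nonroots.enumerate
        x : Fin n → Carrier
        x j = ∑ (λ t → a t * δ (η t) j)
        x-harmonic : Harmonic x
        x-harmonic i = trans (∑-combination-comm (kirchhoff Γ i) a (λ t → δ (η t)))
                             (trans (∑-cong (λ t → cong (a t *_) (∑-*δ (kirchhoff Γ i) (η t)))) (La≡0 i))
        x-roots : ∀ r → p₀ r ≡ nothing → x r ≡ 0#
        x-roots r p₀ᵣ≡nothing = ∑-zero λ t →
          trans (cong (λ b → a t * (if b then 1# else 0#)) (dec-false (η t ≟ r) (nonroot≢root t p₀ᵣ≡nothing))) (zeroʳ (a t))
        x-at-nonroot : x (η k) ≡ a k
        x-at-nonroot = trans (∑-cong (λ t → cong (λ b → a t * (if b then 1# else 0#))
                                   (does-⇔ (mk⇔ (sym ∘ Nonroots.enumerate-injective) (cong η ∘ sym)) (η t ≟ η k) (k ≟ t))))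
                             (∑-*δ a k)

      -- For a root c of p₀, the harmonic vector equal to δ c on the roots; zero for a non-root c.
      rootExtension : Fin n → Fin n → Carrier
      rootExtension c i = if is-just (p₀ c) then 0# else ∑ᴾ (treeWeight c i) * ∑ᴾ (treeWeight c c) ⁻¹

      rootExtension-harmonic : ∀ c → Harmonic (rootExtension c)
      rootExtension-harmonic c i = guarded (is-just (p₀ c))
        where
        κ : Carrier
        κ = ∑ᴾ (treeWeight c c) ⁻¹
        guarded : ∀ b → ∑ (λ j → kirchhoff Γ i j * (if b then 0# else ∑ᴾ (treeWeight c j) * κ)) ≡ 0#
        guarded true  = ∑-zero (λ j → zeroʳ (kirchhoff Γ i j))
        guarded false = begin
          ∑ (λ j → kirchhoff Γ i j * (∑ᴾ (treeWeight c j) * κ))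
            ≡⟨ ∑-cong (λ j → *-assoc (kirchhoff Γ i j) _ κ) ⟨
          ∑ (λ j → kirchhoff Γ i j * ∑ᴾ (treeWeight c j) * κ)
            ≡⟨ *-distribʳ-∑ κ (λ j → kirchhoff Γ i j * ∑ᴾ (treeWeight c j)) ⟨
          ∑ (λ j → kirchhoff Γ i j * ∑ᴾ (treeWeight c j)) * κ
            ≡⟨ cong (_* κ) (treeWeight-harmonic i c) ⟩
          0# * κ
            ≡⟨ zeroˡ κ ⟩
          0# ∎

      rootExtension-roots : ∀ c r → p₀ r ≡ nothing → rootExtension c r ≡ δ c r
      rootExtension-roots c r p₀ᵣ≡nothing with p₀ c in p₀c | c ≟ r
      ... | just _  | yes refl with () ← trans (sym p₀c) p₀ᵣ≡nothing
      ... | just _  | no _     = refl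
      ... | nothing | yes refl = ⁻¹-inverse _ (pos⇒≢0 (∑treeWeight-root-pos p₀-max p₀c))
      ... | nothing | no c≢r   = trans (cong (_* _) (∑treeWeight-between-roots p₀-max p₀c p₀ᵣ≡nothing c≢r)) (zeroˡ _)

      rootFree : Fin n → Fin n → Carrier
      rootFree c j = δ c j - rootExtension c j

      rootFree-roots : ∀ c r → p₀ r ≡ nothing → rootFree c r ≡ 0#
      rootFree-roots c r p₀ᵣ≡nothing = trans (cong (λ t → δ c r - t) (rootExtension-roots c r p₀ᵣ≡nothing)) (-‿inverseʳ (δ c r))

      kirchhoff-rootFree : ∀ i c → ∑ (λ j → kirchhoff Γ i j * rootFree c j) ≡ kirchhoff Γ i c
      kirchhoff-rootFree i c = begin
        ∑ (λ j → kirchhoff Γ i j * rootFree c j)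
          ≡⟨ ∑-cong (λ j → x[y-z]≈xy-xz (kirchhoff Γ i j) _ _) ⟩
        ∑ (λ j → kirchhoff Γ i j * δ c j - kirchhoff Γ i j * rootExtension c j)
          ≡⟨ ∑-distrib-- (λ j → kirchhoff Γ i j * δ c j) (λ j → kirchhoff Γ i j * rootExtension c j) ⟩
        ∑ (λ j → kirchhoff Γ i j * δ c j) - ∑ (λ j → kirchhoff Γ i j * rootExtension c j)
          ≡⟨ cong₂ _-_ (∑-*δ (kirchhoff Γ i) c) (rootExtension-harmonic c i) ⟩
        kirchhoff Γ i c - 0#
          ≡⟨ cong (kirchhoff Γ i c +_) -0#≈0# ⟩
        kirchhoff Γ i c + 0#
          ≡⟨ +-identityʳ _ ⟩
        kirchhoff Γ i c ∎

      kirchhoff-columns-dependent : (cols : Fin (suc (numArcs Γ p₀)) → Fin n) → ¬ LinIndepCols (kirchhoff Γ) cols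
      kirchhoff-columns-dependent cols independent
        with suc-vectors-dependent (numArcs Γ p₀) (λ t k → rootFree (cols t) (Nonroots.enumerate k))
      ... | a , (t₀ , aₜ₀≢0) , combination-at-nonroots = aₜ₀≢0 (independent a combination≡0 t₀)
        where
        combination-vanishes : ∀ j → ∑ (λ t → a t * rootFree (cols t) j) ≡ 0#
        combination-vanishes j with p₀ j in p₀ⱼ
        ... | nothing = ∑-zero (λ t → trans (cong (a t *_) (rootFree-roots (cols t) j p₀ⱼ)) (zeroʳ (a t)))
        ... | just _  with Nonroots.enumerate-complete j (cong is-just p₀ⱼ)
        ...   | k , refl = combination-at-nonroots k
        combination≡0 : ∀ i → ∑ (λ t → a t * kirchhoff Γ i (cols t)) ≡ 0#
        combination≡0 i = begin
          ∑ (λ t → a t * kirchhoff Γ i (cols t))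
            ≡⟨ ∑-cong (λ t → cong (a t *_) (kirchhoff-rootFree i (cols t))) ⟨
          ∑ (λ t → a t * ∑ (λ j → kirchhoff Γ i j * rootFree (cols t) j))
            ≡⟨ ∑-combination-comm (kirchhoff Γ i) a (rootFree ∘ cols) ⟨
          ∑ (λ j → kirchhoff Γ i j * ∑ (λ t → a t * rootFree (cols t) j))
            ≡⟨ ∑-zero (λ j → trans (cong (kirchhoff Γ i j *_) (combination-vanishes j)) (zeroʳ _)) ⟩
          0# ∎

      kirchhoff-rank : HasRank (kirchhoff Γ) (n ℕ.∸ v)
      kirchhoff-rank = subst (HasRank (kirchhoff Γ)) #nonroots≡n∸v
        ((Nonroots.enumerate , kirchhoff-nonroot-columns-independent) , kirchhoff-columns-dependent)

      G⁻¹ : Carrier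
      G⁻¹ = ∑ᴾ forestWeight ⁻¹

      Jbar≡ : ∀ i j → Jbar Γ v i j ≡ ∑ᴾ (treeWeight j i) * G⁻¹
      Jbar≡ i j = cong₂ (λ s t → s * t ⁻¹) (εset-𝓕→ j i) εset-𝓕

      Jbar-column-harmonic : ∀ j → Harmonic (λ i → Jbar Γ v i j)
      Jbar-column-harmonic j i = begin
        ∑ (λ k → kirchhoff Γ i k * Jbar Γ v k j)
          ≡⟨ ∑-cong (λ k → trans (cong (kirchhoff Γ i k *_) (Jbar≡ k j)) (sym (*-assoc _ _ G⁻¹))) ⟩
        ∑ (λ k → kirchhoff Γ i k * ∑ᴾ (treeWeight j k) * G⁻¹)
          ≡⟨ *-distribʳ-∑ G⁻¹ (λ k → kirchhoff Γ i k * ∑ᴾ (treeWeight j k)) ⟨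
        ∑ (λ k → kirchhoff Γ i k * ∑ᴾ (treeWeight j k)) * G⁻¹
          ≡⟨ cong (_* G⁻¹) (treeWeight-harmonic i j) ⟩
        0# * G⁻¹
          ≡⟨ zeroˡ G⁻¹ ⟩
        0# ∎

      Jbar-root-columns-independent : LinIndepCols (Jbar Γ v) Roots.enumerate
      Jbar-root-columns-independent a Ja≡0 s₀ = *-cancelˡ-0 X≢0 (trans (*-comm X (a s₀)) aₛ₀X≡0)
        where
        ρ : Fin (List.length Roots.selected) → Fin n
        ρ = Roots.enumerate
        X : Carrier
        X = Jbar Γ v (ρ s₀) (ρ s₀)
        X≢0 : ¬ X ≡ 0#
        X≢0 = subst (λ t → ¬ t ≡ 0#) (sym (Jbar≡ (ρ s₀) (ρ s₀)))
                (*-nonzero (pos⇒≢0 (∑treeWeight-root-pos p₀-max (root s₀))) (⁻¹-nonzero (pos⇒≢0 (∑forestWeight-pos p₀-max))))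
        diagonal : ∀ s → a s * Jbar Γ v (ρ s₀) (ρ s) ≡ (if does (s₀ ≟ s) then a s * X else 0#)
        diagonal s with s₀ ≟ s
        ... | yes refl = refl
        ... | no s₀≢s  = trans (cong (a s *_) (trans (Jbar≡ (ρ s₀) (ρ s))
                                 (trans (cong (_* G⁻¹) (∑treeWeight-between-roots p₀-max (root s) (root s₀) (s₀≢s ∘ sym ∘ Roots.enumerate-injective)))
                                        (zeroˡ G⁻¹))))
                               (zeroʳ (a s))
        aₛ₀X≡0 : a s₀ * X ≡ 0#
        aₛ₀X≡0 = trans (sym (∑-select s₀ (λ s → a s * X))) (trans (sym (∑-cong diagonal)) (Ja≡0 (ρ s₀)))

      Jbar-columns-dependent : (cols : Fin (suc (List.length Roots.selected)) → Fin n) → ¬ LinIndepCols (Jbar Γ v) cols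
      Jbar-columns-dependent cols independent
        with suc-vectors-dependent (List.length Roots.selected) (λ t s → Jbar Γ v (Roots.enumerate s) (cols t))
      ... | a , (t₀ , aₜ₀≢0) , combination-at-roots = aₜ₀≢0 (independent a (harmonic-zero p₀-forest z-harmonic z-roots) t₀)
        where
        z : Fin n → Carrier
        z i = ∑ (λ t → a t * Jbar Γ v i (cols t))
        z-harmonic : Harmonic z
        z-harmonic i = trans (∑-combination-comm (kirchhoff Γ i) a (λ t k → Jbar Γ v k (cols t)))
                             (∑-zero (λ t → trans (cong (a t *_) (Jbar-column-harmonic (cols t) i)) (zeroʳ (a t))))
        z-roots : ∀ r → p₀ r ≡ nothing → z r ≡ 0#
        z-roots r p₀ᵣ≡nothing with Roots.enumerate-complete r (cong is-nothing p₀ᵣ≡nothing)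
        ... | s , refl = combination-at-roots s

      Jbar-rank : HasRank (Jbar Γ v) v
      Jbar-rank = subst (HasRank (Jbar Γ v)) #roots≡v ((Roots.enumerate , Jbar-root-columns-independent) , Jbar-columns-dependent)

open import Data.Nat using (_≤_)

proposition11 : {c ℓ : Level} (F : OrderedField c ℓ) → let open Over F in
    (n : ℕ) → 2 ≤ n → (Γ : WDigraph n) → (v : ℕ) → IsForestDimension Γ v →
    HasRank (kirchhoff Γ) (n ∸ v) × HasRank (Jbar Γ v) v
proposition11 F n _ Γ v dimension = kirchhoff-rank , Jbar-rank
  where open Ranks F Γ v dimension
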